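{- Let $q=p^f$, $d\ge1$, and let $N\in\mathbb{Z}_+$ have base-$p$ expansion $N=\sum_{i=0}^na_ip^i$ with $a_n\ne0$. Suppose $W_d(N)\ne\emptyset$ and let $\mathbf{X}=(X_1,\ldots,X_d)\in W_d(N)$ be modest or optimal. Then (i) $X_1\ge a_np^n$; in particular $X_1>N/2$. (ii) $N\le\mathrm{wt}(\mathbf{X})<2N$. (iii) If $d\ge2$ then $W_d(N-X_1)=\emptyset$; in particular $\Gamma(N-X_1)\notin I_d$.
   Context: $p$ is prime, $q=p^f$, an integer is $q$-even if divisible by $q-1$, $\mathbb{N}=\{0,1,\ldots\}$. For $d>0$, $N\in\mathbb{N}$, $W_d(N)$ is the set of $(X_1,\ldots,X_d)\in\mathbb{N}^d$ with $N=\sum_iX_i$ with no carry-over of digits in base $p$, and $X_i>0$ $q$-even for $1\le i<d$. Modest = lexicographically largest element of $W_d(N)$; weight $\mathrm{wt}(\mathbf{X})=X_1+2X_2+\cdots+dX_d$; optimal = of minimum weight in $W_d(N)$. For $n\ge0$ with base-$p$ expansion $n=\sum_jb_jp^j$, $\Gamma(n)=[\mu_0,\ldots,\mu_{f-1}]^t$ with $\mu_i=\sum_{j\equiv i\bmod f}b_j$. For vectors, $\bar u>\bar v$ means $u_i\ge v_i$ for all $i$ and $\bar u\ne\bar v$. $\mathfrak{J}=\{\Gamma(n):n>0\text{ is }q\text{ -even}\}$; for $m\ge1$, $I_m$ is the set of $\Gamma(n)$ ($n>0$) such that there exist $\bar v_1,\ldots,\bar v_{m-1}\in\mathfrak{J}$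 with $\Gamma(n)>\bar v_1+\cdots+\bar v_{m-1}$. -}

module Defs where

open import Data.Nat using (ℕ; zero; suc; _+_; _*_; _∸_; _^_; _≤_; _<_)
open import Data.Nat.DivMod using (_/_; _%_)
open import Data.Nat.Divisibility using (_∣_)
open import Data.Fin using (Fin; toℕ)
open import Data.Vec using (Vec; []; _∷_; lookup; map; tabulate; zipWith; foldr; replicate)
open import Data.Product using (Σ; _×_)
open import Data.Empty using (⊥)
open import Relation.Nullary using (¬_)
open import Relation.Binary.PropositionalEquality using (_≡_)

vsum : ∀ {n} → Vec ℕ n → ℕ
vsum = foldr _ _+_ 0

-- j-th base-p digit of n, i.e. ⌊n / p^j⌋ mod p (p = 0 never occurs: p is prime)
digit : (p n j : ℕ) → ℕ
digit zero    n j       = n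
digit (suc k) n zero    = n % suc k
digit (suc k) n (suc j) = digit (suc k) (n / suc k) j

qEven : (p f n : ℕ) → Set
qEven p f n = (p ^ f ∸ 1) ∣ n

NoCarrySum : (p : ℕ) {d : ℕ} → ℕ → Vec ℕ d → Set
NoCarrySum p N X = (vsum X ≡ N) × ((j : ℕ) → vsum (map (λ x → digit p x j) X) < p)

InW : (p f d N : ℕ) → Vec ℕ d → Set
InW p f d N X =
  NoCarrySum p N X ×
  ((i : Fin d) → suc (toℕ i) < d → (0 < lookup X i) × qEven p f (lookup X i))

first : ∀ {d} → Vec ℕ d → ℕ
first []      = 0
first (x ∷ _) = x

wt : ∀ {d} → Vec ℕ d → ℕ
wt {d} X = vsum (zipWith _*_ (tabulate (λ (i : Fin d) → suc (toℕ i))) X)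

data _<lex_ : ∀ {d} → Vec ℕ d → Vec ℕ d → Set where
  here  : ∀ {d x y} {xs ys : Vec ℕ d} → x < y → (x ∷ xs) <lex (y ∷ ys)
  there : ∀ {d x} {xs ys : Vec ℕ d} → xs <lex ys → (x ∷ xs) <lex (x ∷ ys)

Modest : (p f d N : ℕ) → Vec ℕ d → Set
Modest p f d N X = InW p f d N X × ((Y : Vec ℕ d) → InW p f d N Y → ¬ (X <lex Y))

Optimal : (p f d N : ℕ) → Vec ℕ d → Set
Optimal p f d N X = InW p f d N X × ((Y : Vec ℕ d) → InW p f d N Y → wt X ≤ wt Y)

-- Γ(n) = [μ_0, ..., μ_{f-1}], μ_i = Σ_{j ≡ i mod f} b_j.
-- We sum b_{i + k f} over k = 0..n; this covers every j ≤ n, and b_j = 0 for j > n.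
digitSumFrom : (p n i f : ℕ) → ℕ → ℕ
digitSumFrom p n i f zero    = 0
digitSumFrom p n i f (suc k) = digit p n (i + k * f) + digitSumFrom p n i f k

Γ : (p f n : ℕ) → Vec ℕ f
Γ p f n = tabulate (λ (i : Fin f) → digitSumFrom p n (toℕ i) f (suc n))

_>v_ : ∀ {f} → Vec ℕ f → Vec ℕ f → Set
_>v_ {f} u v = ((i : Fin f) → lookup v i ≤ lookup u i) × ¬ (u ≡ v)

vadd : ∀ {f} → Vec ℕ f → Vec ℕ f → Vec ℕ f
vadd = zipWith _+_

vecSum : ∀ {f m} → Vec (Vec ℕ f) m → Vec ℕ f
vecSum {f} = foldr _ vadd (replicate f 0)

InJ : (p f : ℕ) → Vec ℕ f → Set
InJ p f v = Σ ℕ λ n → (0 < n) × qEven p f n × (Γ p f n ≡ v)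

InI : (p f m : ℕ) → Vec ℕ f → Set
InI p f m v =
  (Σ ℕ λ n → (0 < n) × (Γ p f n ≡ v)) ×
  (Σ (Vec (Vec ℕ f) (m ∸ 1)) λ vs →
     ((i : Fin (m ∸ 1)) → InJ p f (lookup vs i)) × (v >v vecSum vs))

module Submission where

open import Defs
open import Data.Nat using (ℕ; _+_; _*_; _∸_; _^_; _≤_; _<_)
open import Data.Nat.Primality using (Prime)
open import Data.Vec using (Vec)
open import Data.Product using (Σ; _×_)
open import Data.Sum using (_⊎_)
open import Relation.Nullary using (¬_)
open import Relation.Binary.PropositionalEquality using (_≡_; _≢_)

open import Data.Nat
open import Data.Nat.Properties
open import Data.Nat.DivMod
open import Data.Nat.Divisibility using (_∣_; divides; ∣⇒≤; ∣m+n∣m⇒∣n; ∣m∣n⇒∣m+n)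
open import Data.Nat.Primality using (¬prime[0]; ¬prime[1])
open import Data.Nat.Tactic.RingSolver using (solve-∀)
open import Data.Fin using (Fin; toℕ) renaming (zero to fzero; suc to fsuc)
import Data.Fin.Properties as Fin
open import Data.Vec using ([]; _∷_; lookup; map; tabulate; zipWith; _[_]≔_)
open import Data.Nat.Induction using (<-wellFounded)
open import Induction.WellFounded using (Acc; acc)
open import Data.Vec.Properties using (lookup∘update; lookup∘update′; map-id)
open import Data.Product using (_,_; proj₁; proj₂)
open import Data.Sum using (inj₁; inj₂)
open import Data.Empty using (⊥-elim)
open import Relation.Nullary using (Dec; yes; no)
open import Relation.Nullary.Decidable using (_×-dec_)
open import Relation.Binary.PropositionalEquality
open import Relation.Binary.Definitions using (tri<; tri≈; tri>)
open import Function using (case_of_; _∘_; id)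

-- Let n be the position of the top digit a_n of N. If X₁ does not carry all of a_n, another coordinate
-- holds a unit p^n, while the digits of X₁ below n contain a part R ≡ p^n (mod q - 1): dividing by
-- p^(n+1) modulo q - 1 turns the p^j (j < n) into powers p^e with e < f, q-evenness of X₁ forces their
-- total to be at least p^(f-1), and such a multiset of powers has a sub-multiset summing to exactly
-- p^(f-1). Trading R for the unit keeps all coordinates q-even and yields
-- an element of W_d(N) that is lexicographically larger and of smaller weight. Hence a modest or optimal
-- X has X₁ ≥ a_n p^n > N/2, which gives (i), and (ii) follows by induction on d (for optimal X, after
-- comparing with an element obtained by repeating the trade). For (iii), any Y ∈ W_d(N - X₁) would give
-- (X₁ + Y₁, Y₂, …) ∈ W_d(N), lexicographically larger than X, and lighter than X when Y is light; and
-- Γ(N - X₁) ∈ I_d produces such a Y by splitting the digits of N - X₁ along the class sums of elements of 𝔍.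

module FiniteSums where

  sumTo : ℕ → (ℕ → ℕ) → ℕ
  sumTo zero    g = 0
  sumTo (suc n) g = sumTo n g + g n

  sumTo-cong : ∀ n {g h} → (∀ j → j < n → g j ≡ h j) → sumTo n g ≡ sumTo n h
  sumTo-cong zero    e = refl
  sumTo-cong (suc n) e = cong₂ _+_ (sumTo-cong n (λ j j<n → e j (m<n⇒m<1+n j<n))) (e n ≤-refl)

  sumTo-zeros : ∀ n g → (∀ j → j < n → g j ≡ 0) → sumTo n g ≡ 0
  sumTo-zeros n g e = trans (sumTo-cong n e) (zeros n)
    where zeros : ∀ n → sumTo n (λ _ → 0) ≡ 0
          zeros zero    = refl
          zeros (suc n) = cong (_+ 0) (zeros n)

  sumTo-unshift : ∀ n g → sumTo (suc n) g ≡ g 0 + sumTo n (λ j → g (suc j))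
  sumTo-unshift zero    g = sym (+-identityʳ (g 0))
  sumTo-unshift (suc n) g = begin
    sumTo n g + g n + g (suc n)                  ≡⟨ cong (_+ g (suc n)) (sumTo-unshift n g) ⟩
    g 0 + sumTo n (λ j → g (suc j)) + g (suc n)  ≡⟨ +-assoc (g 0) _ _ ⟩
    g 0 + (sumTo n (λ j → g (suc j)) + g (suc n)) ∎
    where open ≡-Reasoning

  sumTo-+ : ∀ n g h → sumTo n (λ j → g j + h j) ≡ sumTo n g + sumTo n h
  sumTo-+ zero    g h = refl
  sumTo-+ (suc n) g h rewrite sumTo-+ n g h = shuffle (sumTo n g) (sumTo n h) (g n) (h n)
    where shuffle : ∀ a b c d → a + b + (c + d) ≡ a + c + (b + d)
          shuffle = solve-∀

  sumTo-*ˡ : ∀ n a g → sumTo n (λ j → a * g j) ≡ a * sumTo n g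
  sumTo-*ˡ zero    a g = sym (*-zeroʳ a)
  sumTo-*ˡ (suc n) a g rewrite sumTo-*ˡ n a g = sym (*-distribˡ-+ a (sumTo n g) (g n))

  sumTo-*ʳ : ∀ n a g → sumTo n (λ j → g j * a) ≡ sumTo n g * a
  sumTo-*ʳ n a g = trans (sumTo-cong n (λ j _ → *-comm (g j) a)) (trans (sumTo-*ˡ n a g) (*-comm a _))

  sumTo-extend : ∀ m n g → m ≤ n → (∀ j → m ≤ j → j < n → g j ≡ 0) → sumTo n g ≡ sumTo m g
  sumTo-extend m zero    g z≤n e = refl
  sumTo-extend m (suc n) g m≤1+n e with m ≟ suc n
  ... | yes refl = refl
  ... | no m≢1+n = begin
    sumTo n g + g n ≡⟨ cong (sumTo n g +_) (e n m≤n ≤-refl) ⟩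
    sumTo n g + 0   ≡⟨ +-identityʳ _ ⟩
    sumTo n g       ≡⟨ sumTo-extend m n g m≤n (λ j m≤j j<n → e j m≤j (m<n⇒m<1+n j<n)) ⟩
    sumTo m g       ∎
    where open ≡-Reasoning
          m≤n : m ≤ n
          m≤n = ≤-pred (≤∧≢⇒< m≤1+n m≢1+n)

  sumTo-split : ∀ a b g → sumTo (a + b) g ≡ sumTo a g + sumTo b (λ i → g (a + i))
  sumTo-split a zero    g = trans (cong (λ x → sumTo x g) (+-identityʳ a)) (sym (+-identityʳ _))
  sumTo-split a (suc b) g = begin
    sumTo (a + suc b) g                                ≡⟨ cong (λ x → sumTo x g) (+-suc a b) ⟩
    sumTo (a + b) g + g (a + b)                        ≡⟨ cong (_+ g (a + b)) (sumTo-split a b g) ⟩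
    sumTo a g + sumTo b (λ i → g (a + i)) + g (a + b)  ≡⟨ +-assoc (sumTo a g) _ _ ⟩
    sumTo a g + (sumTo b (λ i → g (a + i)) + g (a + b)) ∎
    where open ≡-Reasoning

  sumTo≡0⇒ : ∀ n g → sumTo n g ≡ 0 → ∀ j → j < n → g j ≡ 0
  sumTo≡0⇒ (suc n) g e j j<1+n with j ≟ n
  ... | yes refl = m+n≡0⇒n≡0 (sumTo n g) e
  ... | no j≢n   = sumTo≡0⇒ n g (m+n≡0⇒m≡0 (sumTo n g) e) j (≤∧≢⇒< (≤-pred j<1+n) j≢n)

  sumTo>0⇒ : ∀ n g → 0 < sumTo n g → Σ ℕ λ j → j < n × 0 < g j
  sumTo>0⇒ zero    g ()
  sumTo>0⇒ (suc n) g pos with g n ≟ 0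
  ... | no gn≢0 = n , ≤-refl , n≢0⇒n>0 gn≢0
  ... | yes gn≡0 with sumTo>0⇒ n g (subst (0 <_) (trans (cong (sumTo n g +_) gn≡0) (+-identityʳ _)) pos)
  ...   | j , j<n , gj>0 = j , m<n⇒m<1+n j<n , gj>0

  ≤-sumTo : ∀ n g j → j < n → g j ≤ sumTo n g
  ≤-sumTo (suc n) g j j<1+n with j ≟ n
  ... | yes refl = m≤n+m (g j) (sumTo n g)
  ... | no j≢n   = ≤-trans (≤-sumTo n g j (≤∧≢⇒< (≤-pred j<1+n) j≢n)) (m≤m+n _ _)

  δ : ℕ → ℕ → ℕ
  δ zero    zero    = 1
  δ zero    (suc j) = 0
  δ (suc n) zero    = 0
  δ (suc n) (suc j) = δ n j

  δ-refl : ∀ n → δ n n ≡ 1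
  δ-refl zero    = refl
  δ-refl (suc n) = δ-refl n

  δ-≢ : ∀ n j → j ≢ n → δ n j ≡ 0
  δ-≢ zero    zero    j≢n = ⊥-elim (j≢n refl)
  δ-≢ zero    (suc j) j≢n = refl
  δ-≢ (suc n) zero    j≢n = refl
  δ-≢ (suc n) (suc j) j≢n = δ-≢ n j (λ e → j≢n (cong suc e))

  δ-+ : ∀ i a b → δ (i + a) (i + b) ≡ δ a b
  δ-+ zero    a b = refl
  δ-+ (suc i) a b = δ-+ i a b

  δ-≤ : ∀ n (c : ℕ → ℕ) → 0 < c n → ∀ j → δ n j ≤ c j
  δ-≤ n c cn>0 j with j ≟ n
  ... | yes refl = subst (_≤ c j) (sym (δ-refl j)) cn>0
  ... | no j≢n   = subst (_≤ c j) (sym (δ-≢ n j j≢n)) z≤n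

  sumTo-δ : ∀ n j (w : ℕ → ℕ) → j < n → sumTo n (λ i → δ j i * w i) ≡ w j
  sumTo-δ (suc n) j w j<1+n with j ≟ n
  ... | yes refl = begin
    sumTo j (λ i → δ j i * w i) + δ j j * w j ≡⟨ cong₂ _+_ (sumTo-zeros j _ off) (cong (_* w j) (δ-refl j)) ⟩
    0 + 1 * w j                               ≡⟨ *-identityˡ (w j) ⟩
    w j                                       ∎
    where open ≡-Reasoning
          off : ∀ i → i < j → δ j i * w i ≡ 0
          off i i<j = cong (_* w i) (δ-≢ j i (λ e → <-irrefl e i<j))
  ... | no j≢n = begin
    sumTo n (λ i → δ j i * w i) + δ j n * w n ≡⟨ cong (λ x → sumTo n (λ i → δ j i * w i) + x * w n) (δ-≢ j n (j≢n ∘ sym)) ⟩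
    sumTo n (λ i → δ j i * w i) + 0           ≡⟨ +-identityʳ _ ⟩
    sumTo n (λ i → δ j i * w i)               ≡⟨ sumTo-δ n j w (≤∧≢⇒< (≤-pred j<1+n) j≢n) ⟩
    w j                                       ∎
    where open ≡-Reasoning

  boundedSearch : ∀ n (Q : ℕ → Set) → (∀ j → Dec (Q j)) →
                  (Σ ℕ λ j → j < n × Q j) ⊎ (∀ j → j < n → ¬ Q j)
  boundedSearch zero    Q Q? = inj₂ (λ j ())
  boundedSearch (suc n) Q Q? with boundedSearch n Q Q?
  ... | inj₁ (j , j<n , q) = inj₁ (j , m<n⇒m<1+n j<n , q)
  ... | inj₂ none with Q? n
  ...   | yes q = inj₁ (n , ≤-refl , q)
  ...   | no ¬q = inj₂ λ j j<1+n → case j ≟ n of λ where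
            (yes refl) → ¬q
            (no j≢n)   → none j (≤∧≢⇒< (≤-pred j<1+n) j≢n)

module Weights where

  wsum : (ℕ → ℕ) → ∀ {d} → Vec ℕ d → ℕ
  wsum h []       = 0
  wsum h (x ∷ xs) = h 0 * x + wsum (h ∘ suc) xs

  private
    zipWith-tabulate≡wsum : ∀ {d} (g : Fin d → ℕ) (h : ℕ → ℕ) → (∀ i → g i ≡ h (toℕ i)) → (xs : Vec ℕ d) →
                            vsum (zipWith _*_ (tabulate g) xs) ≡ wsum h xs
    zipWith-tabulate≡wsum g h g≗h []       = refl
    zipWith-tabulate≡wsum g h g≗h (x ∷ xs) =
      cong₂ _+_ (cong (_* x) (g≗h fzero)) (zipWith-tabulate≡wsum (g ∘ fsuc) (h ∘ suc) (g≗h ∘ fsuc) xs)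

  wt≡wsum : ∀ {d} (X : Vec ℕ d) → wt X ≡ wsum suc X
  wt≡wsum = zipWith-tabulate≡wsum _ suc (λ _ → refl)

  wsum-+ : ∀ {d} m (h : ℕ → ℕ) (xs : Vec ℕ d) → wsum (λ i → m + h i) xs ≡ m * vsum xs + wsum h xs
  wsum-+ m h []       = sym (trans (+-identityʳ (m * 0)) (*-zeroʳ m))
  wsum-+ m h (x ∷ xs) rewrite wsum-+ m (h ∘ suc) xs = shuffle m (h 0) x (vsum xs) (wsum (h ∘ suc) xs)
    where shuffle : ∀ m a x v s → (m + a) * x + (m * v + s) ≡ m * (x + v) + (a * x + s)
          shuffle = solve-∀

  vsum+wt≡wsum : ∀ {d} (xs : Vec ℕ d) → vsum xs + wt xs ≡ wsum (suc ∘ suc) xs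
  vsum+wt≡wsum xs = sym (trans (wsum-+ 1 suc xs) (cong₂ _+_ (*-identityˡ (vsum xs)) (sym (wt≡wsum xs))))

  wt-∷ : ∀ {d} x (xs : Vec ℕ d) → wt (x ∷ xs) ≡ x + (vsum xs + wt xs)
  wt-∷ x xs = trans (wt≡wsum (x ∷ xs)) (cong₂ _+_ (*-identityˡ x) (sym (vsum+wt≡wsum xs)))

  vsum≤wt : ∀ {d} (X : Vec ℕ d) → vsum X ≤ wt X
  vsum≤wt []       = ≤-refl
  vsum≤wt (x ∷ xs) rewrite wt-∷ x xs = +-monoʳ-≤ x (m≤m+n (vsum xs) (wt xs))

  wt-zeros : ∀ {d} (X : Vec ℕ d) → vsum X ≡ 0 → wt X ≡ 0
  wt-zeros []       _    = refl
  wt-zeros (x ∷ xs) sum≡0 = trans (wt-∷ x xs) (cong₂ _+_ x≡0 (cong₂ _+_ xs≡0 (wt-zeros xs xs≡0)))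
    where x≡0 : x ≡ 0
          x≡0 = m+n≡0⇒m≡0 x sum≡0
          xs≡0 : vsum xs ≡ 0
          xs≡0 = m+n≡0⇒n≡0 x sum≡0

  wt-+-head : ∀ {d} x y (ys : Vec ℕ d) → wt ((x + y) ∷ ys) ≡ x + wt (y ∷ ys)
  wt-+-head x y ys = trans (wt-∷ (x + y) ys) (trans (+-assoc x y _) (cong (x +_) (sym (wt-∷ y ys))))

  wt-∷-< : ∀ {d} y (Z : Vec ℕ d) → vsum Z < y → (0 < vsum Z → wt Z < 2 * vsum Z) → wt (y ∷ Z) < 2 * (y + vsum Z)
  wt-∷-< y Z m<y tail with vsum Z in eq
  ... | zero  = begin-strict
    wt (y ∷ Z)     ≡⟨ wt-∷ y Z ⟩
    y + (vsum Z + wt Z) ≡⟨ cong (λ z → y + (z + wt Z)) eq ⟩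
    y + wt Z       ≡⟨ cong (y +_) (wt-zeros Z eq) ⟩
    y + 0          <⟨ +-monoʳ-< y m<y ⟩
    y + y          ≡⟨ double y ⟩
    2 * (y + 0)    ∎
    where open ≤-Reasoning
          double : ∀ y → y + y ≡ 2 * (y + 0)
          double = solve-∀
  ... | suc m = begin-strict
    wt (y ∷ Z)                       ≡⟨ wt-∷ y Z ⟩
    y + (vsum Z + wt Z)              ≡⟨ cong (λ z → y + (z + wt Z)) eq ⟩
    y + (suc m + wt Z)               <⟨ +-monoʳ-< y (+-monoʳ-< (suc m) (tail z<s)) ⟩
    y + (suc m + 2 * suc m)          ≤⟨ +-monoʳ-≤ y (+-monoʳ-≤ (suc m) (+-monoʳ-≤ (suc m) (+-monoˡ-≤ 0 (<⇒≤ m<y)))) ⟩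
    y + (suc m + (suc m + (y + 0)))  ≡⟨ regroup y (suc m) ⟩
    2 * (y + suc m)                  ∎
    where open ≤-Reasoning
          regroup : ∀ y m → y + (m + (m + (y + 0))) ≡ 2 * (y + m)
          regroup = solve-∀

  vsum-map-update : ∀ {d} (g : ℕ → ℕ) (xs : Vec ℕ d) k y →
                    vsum (map g (xs [ k ]≔ y)) + g (lookup xs k) ≡ vsum (map g xs) + g y
  vsum-map-update g (x ∷ xs) fzero    y = swap (g y) (vsum (map g xs)) (g x)
    where swap : ∀ a b c → a + b + c ≡ c + b + a
          swap = solve-∀
  vsum-map-update g (x ∷ xs) (fsuc k) y = begin
    g x + vsum (map g (xs [ k ]≔ y)) + g (lookup xs k)   ≡⟨ +-assoc (g x) _ _ ⟩
    g x + (vsum (map g (xs [ k ]≔ y)) + g (lookup xs k)) ≡⟨ cong (g x +_) (vsum-map-update g xs k y) ⟩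
    g x + (vsum (map g xs) + g y)                        ≡⟨ sym (+-assoc (g x) _ _) ⟩
    g x + vsum (map g xs) + g y                          ∎
    where open ≡-Reasoning

  vsum-update : ∀ {d} (xs : Vec ℕ d) k y → vsum (xs [ k ]≔ y) + lookup xs k ≡ vsum xs + y
  vsum-update xs k y = subst₂ (λ u v → vsum u + lookup xs k ≡ vsum v + y) (map-id (xs [ k ]≔ y)) (map-id xs)
                              (vsum-map-update id xs k y)

  wsum-update : ∀ {d} (h : ℕ → ℕ) (xs : Vec ℕ d) k y →
                wsum h (xs [ k ]≔ y) + h (toℕ k) * lookup xs k ≡ wsum h xs + h (toℕ k) * y
  wsum-update h (x ∷ xs) fzero    y = swap (h 0 * y) (wsum (h ∘ suc) xs) (h 0 * x)
    where swap : ∀ a b c → a + b + c ≡ c + b + a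
          swap = solve-∀
  wsum-update h (x ∷ xs) (fsuc k) y = begin
    h 0 * x + wsum (h ∘ suc) (xs [ k ]≔ y) + h (suc (toℕ k)) * lookup xs k   ≡⟨ +-assoc (h 0 * x) _ _ ⟩
    h 0 * x + (wsum (h ∘ suc) (xs [ k ]≔ y) + h (suc (toℕ k)) * lookup xs k) ≡⟨ cong (h 0 * x +_) (wsum-update (h ∘ suc) xs k y) ⟩
    h 0 * x + (wsum (h ∘ suc) xs + h (suc (toℕ k)) * y)                      ≡⟨ sym (+-assoc (h 0 * x) _ _) ⟩
    h 0 * x + wsum (h ∘ suc) xs + h (suc (toℕ k)) * y                        ∎
    where open ≡-Reasoning

  wt-move-to-head : ∀ {d} x Δ (rest : Vec ℕ d) i y → y + Δ ≡ lookup rest i → 0 < Δ →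
                    wt ((x + Δ) ∷ rest [ i ]≔ y) < wt (x ∷ rest)
  wt-move-to-head x Δ rest i y y+Δ≡ Δ>0 = begin-strict
    wt ((x + Δ) ∷ U)           ≡⟨ trans (wt-∷ (x + Δ) U) (cong (x + Δ +_) (vsum+wt≡wsum U)) ⟩
    x + Δ + wsum h U           <⟨ +-monoˡ-< (wsum h U) (+-monoʳ-< x (m<m+n Δ Δ>0)) ⟩
    x + (Δ + Δ) + wsum h U     ≡⟨ cong (λ z → x + (Δ + z) + wsum h U) (sym (+-identityʳ Δ)) ⟩
    x + 2 * Δ + wsum h U       ≤⟨ +-monoˡ-≤ (wsum h U) (+-monoʳ-≤ x (*-monoˡ-≤ Δ (s≤s (s≤s (z≤n {toℕ i}))))) ⟩
    x + hᵢ * Δ + wsum h U      ≡⟨ trans (+-assoc x _ _) (cong (x +_) (trans (+-comm (hᵢ * Δ) _) moved)) ⟩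
    x + wsum h rest            ≡⟨ sym (trans (wt-∷ x rest) (cong (x +_) (vsum+wt≡wsum rest))) ⟩
    wt (x ∷ rest)              ∎
    where open ≤-Reasoning
          h  = suc ∘ suc
          hᵢ = h (toℕ i)
          U  = rest [ i ]≔ y
          moved : wsum h U + hᵢ * Δ ≡ wsum h rest
          moved = +-cancelʳ-≡ (hᵢ * y) _ _ (begin-equality
            wsum h U + hᵢ * Δ + hᵢ * y    ≡⟨ regroup (wsum h U) hᵢ Δ y ⟩
            wsum h U + hᵢ * (y + Δ)       ≡⟨ cong (λ z → wsum h U + hᵢ * z) y+Δ≡ ⟩
            wsum h U + hᵢ * lookup rest i ≡⟨ wsum-update h rest i y ⟩
            wsum h rest + hᵢ * y          ∎)
            where regroup : ∀ w h d y → w + h * d + h * y ≡ w + h * (y + d)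
                  regroup = solve-∀

  lookup-map≤vsum : ∀ {d} (g : ℕ → ℕ) (xs : Vec ℕ d) k → g (lookup xs k) ≤ vsum (map g xs)
  lookup-map≤vsum g (x ∷ xs) fzero    = m≤m+n (g x) _
  lookup-map≤vsum g (x ∷ xs) (fsuc k) = ≤-trans (lookup-map≤vsum g xs k) (m≤n+m _ (g x))

  lookup≤vsum : ∀ {d} (xs : Vec ℕ d) k → lookup xs k ≤ vsum xs
  lookup≤vsum xs k = subst (lookup xs k ≤_) (cong vsum (map-id xs)) (lookup-map≤vsum id xs k)

  vsum-map>0⇒ : ∀ {d} (g : ℕ → ℕ) (xs : Vec ℕ d) → 0 < vsum (map g xs) → Σ (Fin d) λ k → 0 < g (lookup xs k)
  vsum-map>0⇒ g []       ()
  vsum-map>0⇒ g (x ∷ xs) pos with g x ≟ 0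
  ... | no  gx≢0 = fzero , n≢0⇒n>0 gx≢0
  ... | yes gx≡0 with vsum-map>0⇒ g xs (subst (0 <_) (cong (_+ vsum (map g xs)) gx≡0) pos)
  ...   | k , gk>0 = fsuc k , gk>0

-- The base P ≥ 2 is written as 2 + k so that `digit` computes.
module Expansion (k : ℕ) where
  open FiniteSums
  open Weights

  P : ℕ
  P = suc (suc k)

  fromDigits : ℕ → (ℕ → ℕ) → ℕ
  fromDigits zero    c = 0
  fromDigits (suc L) c = c 0 + P * fromDigits L (c ∘ suc)

  private
    [a+Pb]/P≡b : ∀ a b → a < P → (a + P * b) / P ≡ b
    [a+Pb]/P≡b a b a<P = begin
      (a + P * b) / P   ≡⟨ +-distrib-/-∣ʳ a (divides b (*-comm P b)) ⟩
      a / P + P * b / P ≡⟨ cong₂ _+_ (m<n⇒m/n≡0 a<P) (trans (cong (_/ P) (*-comm P b)) (m*n/n≡m b P)) ⟩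
      b                 ∎
      where open ≡-Reasoning

    digit-[a+Pb]-0 : ∀ a b → a < P → digit P (a + P * b) 0 ≡ a
    digit-[a+Pb]-0 a b a<P =
      trans (cong (λ z → (a + z) % P) (*-comm P b)) (trans ([m+kn]%n≡m%n a b P) (m<n⇒m%n≡m a<P))

    digit-[a+Pb]-suc : ∀ a b j → a < P → digit P (a + P * b) (suc j) ≡ digit P b j
    digit-[a+Pb]-suc a b j a<P = cong (λ x → digit P x j) ([a+Pb]/P≡b a b a<P)

  digit<P : ∀ x j → digit P x j < P
  digit<P x zero    = m%n<n x P
  digit<P x (suc j) = digit<P (x / P) j

  digit-0 : ∀ j → digit P 0 j ≡ 0
  digit-0 zero    = refl
  digit-0 (suc j) = digit-0 j

  n<P^n : ∀ n → n < P ^ n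
  n<P^n zero    = s≤s z≤n
  n<P^n (suc n) = begin-strict
    suc n     ≤⟨ n<P^n n ⟩
    P ^ n     <⟨ m<m*n (P ^ n) P ⦃ >-nonZero (m^n>0 P n) ⦄ (s≤s (s≤s z≤n)) ⟩
    P ^ n * P ≡⟨ *-comm (P ^ n) P ⟩
    P * P ^ n ∎
    where open ≤-Reasoning

  <P^ : ∀ x {L} → x ≤ L → x < P ^ L
  <P^ x x≤L = <-≤-trans (n<P^n x) (^-monoʳ-≤ P x≤L)

  fromDigits-digit : ∀ L x → x < P ^ L → fromDigits L (digit P x) ≡ x
  fromDigits-digit zero    zero    _           = refl
  fromDigits-digit zero    (suc x) (s≤s ())
  fromDigits-digit (suc L) x       x<P^[1+L] = begin
    x % P + P * fromDigits L (digit P (x / P)) ≡⟨ cong (λ e → x % P + P * e) (fromDigits-digit L (x / P) x/P<P^L) ⟩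
    x % P + P * (x / P)                        ≡⟨ cong (x % P +_) (*-comm P (x / P)) ⟩
    x % P + (x / P) * P                        ≡⟨ sym (m≡m%n+[m/n]*n x P) ⟩
    x                                          ∎
    where open ≡-Reasoning
          x/P<P^L : x / P < P ^ L
          x/P<P^L = m<n*o⇒m/o<n (subst (x <_) (*-comm P (P ^ L)) x<P^[1+L])

  digit-fromDigits : ∀ L c → (∀ j → j < L → c j < P) → ∀ j → j < L → digit P (fromDigits L c) j ≡ c j
  digit-fromDigits (suc L) c c<P zero    _           = digit-[a+Pb]-0 (c 0) (fromDigits L (c ∘ suc)) (c<P 0 z<s)
  digit-fromDigits (suc L) c c<P (suc j) (s≤s j<L) =
    trans (digit-[a+Pb]-suc (c 0) (fromDigits L (c ∘ suc)) j (c<P 0 z<s))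
          (digit-fromDigits L (c ∘ suc) (λ i i<L → c<P (suc i) (s≤s i<L)) j j<L)

  digit-fromDigits-≥ : ∀ L c → (∀ j → j < L → c j < P) → ∀ j → L ≤ j → digit P (fromDigits L c) j ≡ 0
  digit-fromDigits-≥ zero    c c<P j       _         = digit-0 j
  digit-fromDigits-≥ (suc L) c c<P (suc j) (s≤s L≤j) =
    trans (digit-[a+Pb]-suc (c 0) (fromDigits L (c ∘ suc)) j (c<P 0 z<s))
          (digit-fromDigits-≥ L (c ∘ suc) (λ i i<L → c<P (suc i) (s≤s i<L)) j L≤j)

  digit-fromDigits′ : ∀ L c → (∀ j → c j < P) → (∀ j → L ≤ j → c j ≡ 0) → ∀ j → digit P (fromDigits L c) j ≡ c j
  digit-fromDigits′ L c c<P c≥L≡0 j with j <? L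
  ... | yes j<L = digit-fromDigits L c (λ i _ → c<P i) j j<L
  ... | no  j≮L = trans (digit-fromDigits-≥ L c (λ i _ → c<P i) j (≮⇒≥ j≮L)) (sym (c≥L≡0 j (≮⇒≥ j≮L)))

  digit-≥ : ∀ L x → x < P ^ L → ∀ j → L ≤ j → digit P x j ≡ 0
  digit-≥ L x x<P^L j L≤j =
    trans (cong (λ y → digit P y j) (sym (fromDigits-digit L x x<P^L)))
          (digit-fromDigits-≥ L (digit P x) (λ i _ → digit<P x i) j L≤j)

  fromDigits-< : ∀ L c → (∀ j → j < L → c j < P) → fromDigits L c < P ^ L
  fromDigits-< zero    c c<P = s≤s z≤n
  fromDigits-< (suc L) c c<P = begin-strict
    c 0 + P * r   <⟨ +-monoˡ-< (P * r) (c<P 0 z<s) ⟩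
    P + P * r     ≡⟨ sym (*-suc P r) ⟩
    P * suc r     ≤⟨ *-monoʳ-≤ P (fromDigits-< L (c ∘ suc) (λ i i<L → c<P (suc i) (s≤s i<L))) ⟩
    P * P ^ L     ∎
    where open ≤-Reasoning
          r = fromDigits L (c ∘ suc)

  fromDigits-cong : ∀ L {c c′} → (∀ j → j < L → c j ≡ c′ j) → fromDigits L c ≡ fromDigits L c′
  fromDigits-cong zero    e = refl
  fromDigits-cong (suc L) e =
    cong₂ (λ a b → a + P * b) (e 0 z<s) (fromDigits-cong L (λ j j<L → e (suc j) (s≤s j<L)))

  fromDigits-+ : ∀ L c c′ → fromDigits L (λ j → c j + c′ j) ≡ fromDigits L c + fromDigits L c′
  fromDigits-+ zero    c c′ = refl
  fromDigits-+ (suc L) c c′ rewrite fromDigits-+ L (c ∘ suc) (c′ ∘ suc) =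
    shuffle (c 0) (c′ 0) P (fromDigits L (c ∘ suc)) (fromDigits L (c′ ∘ suc))
    where shuffle : ∀ a b p x y → a + b + p * (x + y) ≡ a + p * x + (b + p * y)
          shuffle = solve-∀

  fromDigits-mono : ∀ L {c c′} → (∀ j → j < L → c j ≤ c′ j) → fromDigits L c ≤ fromDigits L c′
  fromDigits-mono zero    le = z≤n
  fromDigits-mono (suc L) le =
    +-mono-≤ (le 0 z<s) (*-monoʳ-≤ P (fromDigits-mono L (λ j j<L → le (suc j) (s≤s j<L))))

  fromDigits-zeros : ∀ L c → (∀ j → j < L → c j ≡ 0) → fromDigits L c ≡ 0
  fromDigits-zeros zero    c c≡0 = refl
  fromDigits-zeros (suc L) c c≡0
    rewrite c≡0 0 z<s | fromDigits-zeros L (c ∘ suc) (λ j j<L → c≡0 (suc j) (s≤s j<L)) = *-zeroʳ P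

  fromDigits≡0⇒ : ∀ L c → fromDigits L c ≡ 0 → ∀ j → j < L → c j ≡ 0
  fromDigits≡0⇒ (suc L) c e zero    _         = m+n≡0⇒m≡0 (c 0) e
  fromDigits≡0⇒ (suc L) c e (suc j) (s≤s j<L) =
    fromDigits≡0⇒ L (c ∘ suc) (m*n≡0⇒m≡0 (fromDigits L (c ∘ suc)) P (trans (*-comm (fromDigits L (c ∘ suc)) P) (m+n≡0⇒n≡0 (c 0) e))) j j<L

  fromDigits-δ : ∀ L n → n < L → fromDigits L (δ n) ≡ P ^ n
  fromDigits-δ (suc L) zero    _ rewrite fromDigits-zeros L (δ 0 ∘ suc) (λ _ _ → refl) = cong suc (*-zeroʳ P)
  fromDigits-δ (suc L) (suc n) (s≤s n<L) = cong (P *_) (fromDigits-δ L n n<L)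

  fromDigits-sumTo : ∀ L c → fromDigits L c ≡ sumTo L (λ j → c j * P ^ j)
  fromDigits-sumTo zero    c = refl
  fromDigits-sumTo (suc L) c = begin
    c 0 + P * fromDigits L (c ∘ suc)                  ≡⟨ cong (λ e → c 0 + P * e) (fromDigits-sumTo L (c ∘ suc)) ⟩
    c 0 + P * sumTo L (λ j → c (suc j) * P ^ j)       ≡⟨ cong (c 0 +_) (sym (sumTo-*ˡ L P _)) ⟩
    c 0 + sumTo L (λ j → P * (c (suc j) * P ^ j))     ≡⟨ cong₂ _+_ (sym (*-identityʳ (c 0))) (sumTo-cong L (λ j _ → swap (c (suc j)) P (P ^ j))) ⟩
    c 0 * 1 + sumTo L (λ j → c (suc j) * (P * P ^ j)) ≡⟨ sym (sumTo-unshift L (λ j → c j * P ^ j)) ⟩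
    sumTo (suc L) (λ j → c j * P ^ j)                 ∎
    where open ≡-Reasoning
          swap : ∀ a b x → b * (a * x) ≡ a * (b * x)
          swap = solve-∀

  fromDigits-extend : ∀ M L c → M ≤ L → (∀ j → M ≤ j → j < L → c j ≡ 0) → fromDigits L c ≡ fromDigits M c
  fromDigits-extend M L c M≤L c≡0 = begin
    fromDigits L c                ≡⟨ fromDigits-sumTo L c ⟩
    sumTo L (λ j → c j * P ^ j)   ≡⟨ sumTo-extend M L _ M≤L (λ j M≤j j<L → cong (_* P ^ j) (c≡0 j M≤j j<L)) ⟩
    sumTo M (λ j → c j * P ^ j)   ≡⟨ sym (fromDigits-sumTo M c) ⟩
    fromDigits M c                ∎
    where open ≡-Reasoning

  split-at-top : ∀ x n → (∀ j → n < j → digit P x j ≡ 0) → x ≡ fromDigits n (digit P x) + digit P x n * P ^ n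
  split-at-top x n top = begin
    x                                                         ≡⟨ sym (fromDigits-digit L x (<P^ x (m≤n⇒m≤1+n (m≤m+n x n)))) ⟩
    fromDigits L (digit P x)                                  ≡⟨ fromDigits-extend (suc n) L (digit P x) (s≤s (m≤n+m n x)) (λ j n<j _ → top j n<j) ⟩
    fromDigits (suc n) (digit P x)                            ≡⟨ fromDigits-sumTo (suc n) (digit P x) ⟩
    sumTo n (λ j → digit P x j * P ^ j) + digit P x n * P ^ n ≡⟨ cong (_+ digit P x n * P ^ n) (sym (fromDigits-sumTo n (digit P x))) ⟩
    fromDigits n (digit P x) + digit P x n * P ^ n            ∎
    where open ≡-Reasoning
          L = suc (x + n)

  top*P^n≤ : ∀ x n → (∀ j → n < j → digit P x j ≡ 0) → digit P x n * P ^ n ≤ x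
  top*P^n≤ x n top = subst (digit P x n * P ^ n ≤_) (sym (split-at-top x n top)) (m≤n+m _ _)

  <[1+top]*P^n : ∀ x n → (∀ j → n < j → digit P x j ≡ 0) → x < suc (digit P x n) * P ^ n
  <[1+top]*P^n x n top = subst (_< suc (digit P x n) * P ^ n) (sym (split-at-top x n top))
    (+-monoˡ-< (digit P x n * P ^ n) (fromDigits-< n (digit P x) (λ j _ → digit<P x j)))

  topDigit : ∀ x → 0 < x → Σ ℕ λ n → (digit P x n ≢ 0) × (∀ j → n < j → digit P x j ≡ 0)
  topDigit x x>0 = search x (digit-≥ x x (n<P^n x))
    where
      search : ∀ B → (∀ j → B ≤ j → digit P x j ≡ 0) → Σ ℕ λ n → (digit P x n ≢ 0) × (∀ j → n < j → digit P x j ≡ 0)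
      search zero    zeros = ⊥-elim (<-irrefl (sym x≡0) x>0)
        where x≡0 : x ≡ 0
              x≡0 = trans (sym (fromDigits-digit x x (n<P^n x))) (fromDigits-zeros x _ (λ j _ → zeros j z≤n))
      search (suc B) zeros with digit P x B ≟ 0
      ... | no  d≢0 = B , d≢0 , zeros
      ... | yes d≡0 = search B λ j B≤j → case j ≟ B of λ where
              (yes refl) → d≡0
              (no j≢B)   → zeros j (≤∧≢⇒< B≤j (j≢B ∘ sym))

  digitSum : ∀ {d} → Vec ℕ d → ℕ → ℕ
  digitSum X j = vsum (map (λ x → digit P x j) X)

  fromDigits-digitSum : ∀ L {d} (X : Vec ℕ d) → vsum X < P ^ L → fromDigits L (digitSum X) ≡ vsum X
  fromDigits-digitSum L []       _           = fromDigits-zeros L _ (λ _ _ → refl)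
  fromDigits-digitSum L (x ∷ xs) sum<P^L = begin
    fromDigits L (λ j → digit P x j + digitSum xs j)        ≡⟨ fromDigits-+ L (digit P x) (digitSum xs) ⟩
    fromDigits L (digit P x) + fromDigits L (digitSum xs)   ≡⟨ cong₂ _+_ (fromDigits-digit L x (≤-<-trans (m≤m+n x (vsum xs)) sum<P^L))
                                                                         (fromDigits-digitSum L xs (≤-<-trans (m≤n+m (vsum xs) x) sum<P^L)) ⟩
    x + vsum xs                                             ∎
    where open ≡-Reasoning

  digit-noCarrySum : ∀ {d N} {X : Vec ℕ d} → NoCarrySum P N X → ∀ j → digit P N j ≡ digitSum X j
  digit-noCarrySum {X = X} (refl , noCarry) j = begin
    digit P (vsum X) j                          ≡⟨ cong (λ y → digit P y j) (sym (fromDigits-digitSum L X (<P^ (vsum X) (m≤n⇒m≤1+n (m≤m+n (vsum X) j))))) ⟩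
    digit P (fromDigits L (digitSum X)) j       ≡⟨ digit-fromDigits L (digitSum X) (λ i _ → noCarry i) j (s≤s (m≤n+m j _)) ⟩
    digitSum X j                                ∎
    where open ≡-Reasoning
          L = suc (vsum X + j)

  digit-held-elsewhere : ∀ {d N x n} {xs : Vec ℕ d} → NoCarrySum P N (x ∷ xs) → digit P x n < digit P N n →
                         Σ (Fin d) λ i → 0 < digit P (lookup xs i) n
  digit-held-elsewhere {N = N} {x} {n} {xs} noCarry xₙ<Nₙ = vsum-map>0⇒ (λ y → digit P y n) xs
    (<-≤-trans (m<n⇒0<n∸m xₙ<Nₙ)
               (≤-reflexive (trans (cong (_∸ digit P x n) (digit-noCarrySum {X = x ∷ xs} noCarry n)) (m+n∸m≡n (digit P x n) _))))

  NoCarry₂ : ℕ → ℕ → Set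
  NoCarry₂ x y = ∀ j → digit P x j + digit P y j < P

  digit-+ : ∀ x y → NoCarry₂ x y → ∀ j → digit P (x + y) j ≡ digit P x j + digit P y j
  digit-+ x y noCarry j = begin
    digit P (x + y) j                     ≡⟨ cong (λ z → digit P (x + z) j) (sym (+-identityʳ y)) ⟩
    digit P (x + (y + 0)) j               ≡⟨ digit-noCarrySum {X = x ∷ y ∷ []} (refl , noCarry′) j ⟩
    digit P x j + (digit P y j + 0)       ≡⟨ cong (digit P x j +_) (+-identityʳ _) ⟩
    digit P x j + digit P y j             ∎
    where open ≡-Reasoning
          noCarry′ : ∀ i → digit P x i + (digit P y i + 0) < P
          noCarry′ i = subst (λ z → digit P x i + z < P) (sym (+-identityʳ _)) (noCarry i)

  digit-head≤ : ∀ {d N x} {xs : Vec ℕ d} → NoCarrySum P N (x ∷ xs) → ∀ j → digit P x j ≤ digit P N j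
  digit-head≤ {x = x} {xs} noCarry j = subst (digit P x j ≤_) (sym (digit-noCarrySum {X = x ∷ xs} noCarry j)) (m≤m+n _ _)

  digit-head-above : ∀ {d N x n} {xs : Vec ℕ d} → NoCarrySum P N (x ∷ xs) →
                     (∀ j → n < j → digit P N j ≡ 0) → ∀ j → n < j → digit P x j ≡ 0
  digit-head-above {x = x} {xs = xs} noCarry top j n<j = n≤0⇒n≡0 (subst (digit P x j ≤_) (top j n<j) (digit-head≤ {xs = xs} noCarry j))

  module _ (L : ℕ) (c a : ℕ → ℕ) (c<P : ∀ j → c j < P) (c-outside : ∀ j → L ≤ j → c j ≡ 0) (a≤c : ∀ j → a j ≤ c j) where

    fromDigits-split : fromDigits L a + fromDigits L (λ j → c j ∸ a j) ≡ fromDigits L c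
    fromDigits-split = trans (sym (fromDigits-+ L a _)) (fromDigits-cong L (λ j _ → m+[n∸m]≡n (a≤c j)))

    fromDigits-split-noCarry : NoCarry₂ (fromDigits L a) (fromDigits L (λ j → c j ∸ a j))
    fromDigits-split-noCarry j = subst (_< P) (sym (trans (cong₂ _+_ digit-a digit-c∸a) (m+[n∸m]≡n (a≤c j)))) (c<P j)
      where
        digit-a : digit P (fromDigits L a) j ≡ a j
        digit-a = digit-fromDigits′ L a (λ i → ≤-<-trans (a≤c i) (c<P i))
                    (λ i L≤i → n≤0⇒n≡0 (subst (a i ≤_) (c-outside i L≤i) (a≤c i))) j
        digit-c∸a : digit P (fromDigits L (λ i → c i ∸ a i)) j ≡ c j ∸ a j
        digit-c∸a = digit-fromDigits′ L (λ i → c i ∸ a i) (λ i → ≤-<-trans (m∸n≤m (c i) (a i)) (c<P i))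
                      (λ i L≤i → trans (cong (_∸ a i) (c-outside i L≤i)) (0∸n≡0 (a i))) j

  module Membership (f : ℕ) where

    InW-single : ∀ {M y} → InW P f 1 M (y ∷ []) → y ≡ M
    InW-single {y = y} ((sum , _) , _) = trans (sym (+-identityʳ y)) sum

    InW-head≤ : ∀ {d N x} {xs : Vec ℕ d} → InW P f (suc d) N (x ∷ xs) → x ≤ N
    InW-head≤ {xs = xs} ((refl , _) , _) = m≤m+n _ (vsum xs)

    InW-tail : ∀ {d N x} {xs : Vec ℕ d} → InW P f (suc d) N (x ∷ xs) → InW P f d (N ∸ x) xs
    InW-tail {x = x} {xs} ((refl , noCarry) , cond) =
      (sym (m+n∸m≡n x (vsum xs)) , λ j → ≤-<-trans (m≤n+m _ (digit P x j)) (noCarry j)) ,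
      λ i 2+i≤d → cond (fsuc i) (s≤s 2+i≤d)

    InW-noCarry₂ : ∀ {d N x} {xs : Vec ℕ d} → InW P f (suc d) N (x ∷ xs) → NoCarry₂ x (N ∸ x)
    InW-noCarry₂ {x = x} {xs} w@((_ , noCarry) , _) j =
      subst (λ z → digit P x j + z < P) (sym (digit-noCarrySum {X = xs} (proj₁ (InW-tail w)) j)) (noCarry j)

    InW-head : ∀ {d N x} {xs : Vec ℕ d} → InW P f (suc d) N (x ∷ xs) → 1 ≤ d → (0 < x) × qEven P f x
    InW-head (_ , cond) 1≤d = cond fzero (s≤s 1≤d)

    InW-∷ : ∀ {d M N x} {ys : Vec ℕ d} → InW P f d M ys → NoCarry₂ x M → (1 ≤ d → (0 < x) × qEven P f x) →
            x + M ≡ N → InW P f (suc d) N (x ∷ ys)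
    InW-∷ {x = x} {ys} w@((refl , _) , cond) noCarry head refl =
      (refl , λ j → subst (λ z → digit P x j + z < P) (digit-noCarrySum {X = ys} (proj₁ w) j) (noCarry j)) , cond′
      where cond′ : (i : Fin _) → suc (toℕ i) < _ → _
            cond′ fzero    (s≤s 1≤d) = head 1≤d
            cond′ (fsuc i) (s≤s 2+i≤d) = cond i 2+i≤d

module Congruence (k f′ : ℕ) where
  open FiniteSums
  open Expansion k

  f : ℕ
  f = suc f′

  Q : ℕ
  Q = P ^ f ∸ 1

  -- Congruence modulo Q, phrased without subtraction.
  infix 4 _≈_
  _≈_ : ℕ → ℕ → Set
  a ≈ b = Σ ℕ λ u → Σ ℕ λ v → a + u * Q ≡ b + v * Q

  ≈-refl : ∀ {a} → a ≈ a
  ≈-refl = 0 , 0 , refl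

  ≈-reflexive : ∀ {a b} → a ≡ b → a ≈ b
  ≈-reflexive refl = ≈-refl

  ≈-sym : ∀ {a b} → a ≈ b → b ≈ a
  ≈-sym (u , v , e) = v , u , sym e

  ≈-trans : ∀ {a b c} → a ≈ b → b ≈ c → a ≈ c
  ≈-trans {a} {b} {c} (u , v , e) (u′ , v′ , e′) = u + u′ , v′ + v , (begin
    a + (u + u′) * Q     ≡⟨ assoc a u u′ Q ⟩
    (a + u * Q) + u′ * Q ≡⟨ cong (_+ u′ * Q) e ⟩
    (b + v * Q) + u′ * Q ≡⟨ swap b v u′ Q ⟩
    (b + u′ * Q) + v * Q ≡⟨ cong (_+ v * Q) e′ ⟩
    (c + v′ * Q) + v * Q ≡⟨ sym (assoc c v′ v Q) ⟩
    c + (v′ + v) * Q     ∎)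
    where open ≡-Reasoning
          assoc : ∀ a u u′ q → a + (u + u′) * q ≡ (a + u * q) + u′ * q
          assoc = solve-∀
          swap : ∀ b v u′ q → (b + v * q) + u′ * q ≡ (b + u′ * q) + v * q
          swap = solve-∀

  ≈-+ : ∀ {a b c d} → a ≈ b → c ≈ d → a + c ≈ b + d
  ≈-+ {a} {b} {c} {d} (u , v , e) (u′ , v′ , e′) = u + u′ , v + v′ , (begin
    a + c + (u + u′) * Q       ≡⟨ shuffle a c u u′ Q ⟩
    (a + u * Q) + (c + u′ * Q) ≡⟨ cong₂ _+_ e e′ ⟩
    (b + v * Q) + (d + v′ * Q) ≡⟨ sym (shuffle b d v v′ Q) ⟩
    b + d + (v + v′) * Q       ∎)
    where open ≡-Reasoning
          shuffle : ∀ a c u u′ q → a + c + (u + u′) * q ≡ (a + u * q) + (c + u′ * q)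
          shuffle = solve-∀

  ≈-*ˡ : ∀ m {a b} → a ≈ b → m * a ≈ m * b
  ≈-*ˡ m {a} {b} (u , v , e) = m * u , m * v , (begin
    m * a + m * u * Q ≡⟨ distrib m a u Q ⟩
    m * (a + u * Q)   ≡⟨ cong (m *_) e ⟩
    m * (b + v * Q)   ≡⟨ sym (distrib m b v Q) ⟩
    m * b + m * v * Q ∎)
    where open ≡-Reasoning
          distrib : ∀ m a u q → m * a + m * u * q ≡ m * (a + u * q)
          distrib = solve-∀

  ≈-*ʳ : ∀ m {a b} → a ≈ b → a * m ≈ b * m
  ≈-*ʳ m {a} {b} a≈b = subst₂ _≈_ (*-comm m a) (*-comm m b) (≈-*ˡ m a≈b)

  ≈-cancelˡ-+ : ∀ {a b c d} → a + b ≡ c + d → b ≈ d → a ≈ c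
  ≈-cancelˡ-+ {a} {b} {c} {d} e (u , v , e′) = v , u , +-cancelʳ-≡ _ _ _ (begin
    a + v * Q + (b + u * Q)   ≡⟨ shuffle a (v * Q) b (u * Q) ⟩
    (a + b) + (u * Q + v * Q) ≡⟨ cong (_+ (u * Q + v * Q)) e ⟩
    (c + d) + (u * Q + v * Q) ≡⟨ shuffle′ c d (u * Q) (v * Q) ⟩
    c + u * Q + (d + v * Q)   ≡⟨ cong (c + u * Q +_) (sym e′) ⟩
    c + u * Q + (b + u * Q)   ∎)
    where open ≡-Reasoning
          shuffle : ∀ a x b y → a + x + (b + y) ≡ (a + b) + (y + x)
          shuffle = solve-∀
          shuffle′ : ∀ c d x y → (c + d) + (x + y) ≡ c + x + (d + y)
          shuffle′ = solve-∀

  ≈-sumTo : ∀ n {g h} → (∀ j → j < n → g j ≈ h j) → sumTo n g ≈ sumTo n h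
  ≈-sumTo zero    g≈h = ≈-refl
  ≈-sumTo (suc n) g≈h = ≈-+ (≈-sumTo n (λ j j<n → g≈h j (m<n⇒m<1+n j<n))) (g≈h n ≤-refl)

  ∣⇒≈0 : ∀ {a} → Q ∣ a → a ≈ 0
  ∣⇒≈0 (divides u refl) = 0 , u , +-identityʳ _

  ≈0⇒∣ : ∀ {a} → a ≈ 0 → Q ∣ a
  ≈0⇒∣ {a} (u , v , e) = ∣m+n∣m⇒∣n (divides v (trans (+-comm (u * Q) a) e)) (divides u refl)

  ∣-resp-≈ : ∀ {a b} → a ≈ b → Q ∣ a → Q ∣ b
  ∣-resp-≈ a≈b Q∣a = ≈0⇒∣ (≈-trans (≈-sym a≈b) (∣⇒≈0 Q∣a))

  ∣∧<⇒≡0 : ∀ {s} → Q ∣ s → s < Q → s ≡ 0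
  ∣∧<⇒≡0 {zero}  _   _   = refl
  ∣∧<⇒≡0 {suc s} Q∣s s<Q = ⊥-elim (<⇒≱ s<Q (∣⇒≤ Q∣s))

  P^f≈1 : P ^ f ≈ 1
  P^f≈1 = 0 , 1 , trans (+-identityʳ _) (trans (sym (m+[n∸m]≡n (m^n>0 P f))) (cong (1 +_) (sym (+-identityʳ Q))))

  [P^f]^t≈1 : ∀ t → (P ^ f) ^ t ≈ 1
  [P^f]^t≈1 zero    = ≈-refl
  [P^f]^t≈1 (suc t) = ≈-trans (≈-*ˡ (P ^ f) ([P^f]^t≈1 t)) (subst (_≈ 1) (sym (*-identityʳ (P ^ f))) P^f≈1)

  P^[m+t*f]≈P^m : ∀ m t → P ^ (m + t * f) ≈ P ^ m
  P^[m+t*f]≈P^m m t = subst (_≈ P ^ m) powers (subst (P ^ m * (P ^ f) ^ t ≈_) (*-identityʳ (P ^ m)) (≈-*ˡ (P ^ m) ([P^f]^t≈1 t)))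
    where powers : P ^ m * (P ^ f) ^ t ≡ P ^ (m + t * f)
          powers = trans (cong (P ^ m *_) (trans (^-*-assoc P f t) (cong (P ^_) (*-comm f t))))
                         (sym (^-distribˡ-+-* P m (t * f)))

  P^≈P^[%f] : ∀ a → P ^ a ≈ P ^ (a % f)
  P^≈P^[%f] a = subst (λ z → P ^ z ≈ P ^ (a % f)) (sym (m≡m%n+[m/n]*n a f)) (P^[m+t*f]≈P^m (a % f) (a / f))

  P^-≈ : ∀ a b → a % f ≡ b % f → P ^ a ≈ P ^ b
  P^-≈ a b a≡b = ≈-trans (P^≈P^[%f] a) (subst (λ z → P ^ z ≈ P ^ b) (sym a≡b) (≈-sym (P^≈P^[%f] b)))

  -- P is invertible modulo Q: multiplying by P ^ (m * f′) undoes P ^ m.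
  ≈-cancel-P^ : ∀ m {a b} → P ^ m * a ≈ P ^ m * b → a ≈ b
  ≈-cancel-P^ m {a} {b} Pa≈Pb = ≈-trans (≈-sym (undo a)) (≈-trans (≈-*ˡ (P ^ (m * f′)) Pa≈Pb) (undo b))
    where
      undo : ∀ x → P ^ (m * f′) * (P ^ m * x) ≈ x
      undo x = subst (_≈ x) (powers x) (subst ((P ^ f) ^ m * x ≈_) (*-identityˡ x) (≈-*ʳ x ([P^f]^t≈1 m)))
        where powers : ∀ x → (P ^ f) ^ m * x ≡ P ^ (m * f′) * (P ^ m * x)
              powers x = begin
                (P ^ f) ^ m * x            ≡⟨ cong (_* x) (^-*-assoc P f m) ⟩
                P ^ (f * m) * x            ≡⟨ cong (λ z → P ^ z * x) (trans (*-comm f m) (*-suc m f′)) ⟩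
                P ^ (m + m * f′) * x       ≡⟨ cong (_* x) (^-distribˡ-+-* P m (m * f′)) ⟩
                P ^ m * P ^ (m * f′) * x   ≡⟨ cong (_* x) (*-comm (P ^ m) _) ⟩
                P ^ (m * f′) * P ^ m * x   ≡⟨ *-assoc (P ^ (m * f′)) _ _ ⟩
                P ^ (m * f′) * (P ^ m * x) ∎
                where open ≡-Reasoning

-- Sub-multisets of a multiset of powers P ^ e j (j < n, with multiplicity c j).
module Subsums (k n : ℕ) (e : ℕ → ℕ) where
  open FiniteSums
  open Expansion k

  total : (ℕ → ℕ) → ℕ
  total c = sumTo n (λ j → c j * P ^ e j)

  ExponentsBelow : ℕ → (ℕ → ℕ) → Set
  ExponentsBelow E c = ∀ j → j < n → E < e j → c j ≡ 0

  Subsum : (ℕ → ℕ) → ℕ → Set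
  Subsum c T = Σ (ℕ → ℕ) λ r → (∀ j → r j ≤ c j) × (∀ j → n ≤ j → r j ≡ 0) × total r ≡ T

  total-split : ∀ c r → (∀ j → r j ≤ c j) → total c ≡ total r + total (λ j → c j ∸ r j)
  total-split c r r≤c = trans (sumTo-cong n λ j _ → trans (cong (_* P ^ e j) (sym (m+[n∸m]≡n (r≤c j))))
                                                           (*-distribʳ-+ (P ^ e j) (r j) _))
                              (sumTo-+ n _ _)

  subsum-single : ∀ c j → j < n → 0 < c j → Subsum c (P ^ e j)
  subsum-single c j j<n cj>0 = δ j , δ-≤ j c cj>0 , outside , sumTo-δ n j (λ i → P ^ e i) j<n
    where outside : ∀ i → n ≤ i → δ j i ≡ 0
          outside i n≤i = δ-≢ j i (λ i≡j → <-irrefl refl (<-≤-trans j<n (subst (n ≤_) i≡j n≤i)))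

  -- Greedy from the largest exponent down: P ^ (1 + E) is P copies of P ^ E.
  mutual
    subsum-P^ : ∀ E c → ExponentsBelow E c → P ^ E ≤ total c → Subsum c (P ^ E)
    subsum-P^ zero c below big with sumTo>0⇒ n _ big
    ... | j , j<n , term>0 = subst (Subsum c) (cong (P ^_) ej≡0) (subsum-single c j j<n cj>0)
      where cj>0 : 0 < c j
            cj>0 = case c j ≟ 0 of λ where
                     (yes cj≡0) → ⊥-elim (<-irrefl refl (<-≤-trans term>0 (≤-reflexive (cong (_* P ^ e j) cj≡0))))
                     (no  cj≢0) → n≢0⇒n>0 cj≢0
            ej≡0 : e j ≡ 0
            ej≡0 = case e j ≟ 0 of λ where
                     (yes ej≡0) → ej≡0
                     (no  ej≢0) → ⊥-elim (<-irrefl (sym (below j j<n (n≢0⇒n>0 ej≢0))) cj>0)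
    subsum-P^ (suc E) c below big
      with boundedSearch n (λ j → e j ≡ suc E × 0 < c j) (λ j → (e j ≟ suc E) ×-dec (1 ≤? c j))
    ... | inj₁ (j , j<n , ej≡1+E , cj>0) = subst (Subsum c) (cong (P ^_) ej≡1+E) (subsum-single c j j<n cj>0)
    ... | inj₂ none = subsum-t*P^ E P c below′ big
      where below′ : ExponentsBelow E c
            below′ j j<n E<ej with e j ≟ suc E | c j ≟ 0
            ... | _          | yes cj≡0 = cj≡0
            ... | yes ej≡1+E | no  cj≢0 = ⊥-elim (none j j<n (ej≡1+E , n≢0⇒n>0 cj≢0))
            ... | no  ej≢1+E | no  cj≢0 = below j j<n (≤∧≢⇒< E<ej (ej≢1+E ∘ sym))

    subsum-t*P^ : ∀ E t c → ExponentsBelow E c → t * P ^ E ≤ total c → Subsum c (t * P ^ E)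
    subsum-t*P^ E zero    c below big = (λ _ → 0) , (λ _ → z≤n) , (λ _ _ → refl) , sumTo-zeros n _ (λ _ _ → refl)
    subsum-t*P^ E (suc t) c below big with subsum-t*P^ E t c below (≤-trans (m≤n+m _ (P ^ E)) big)
    ... | r₁ , r₁≤c , r₁-outside , total-r₁ with subsum-P^ E (λ j → c j ∸ r₁ j) below′ big′
      where
        below′ : ExponentsBelow E (λ j → c j ∸ r₁ j)
        below′ j j<n E<ej = trans (cong (_∸ r₁ j) (below j j<n E<ej)) (0∸n≡0 (r₁ j))
        big′ : P ^ E ≤ total (λ j → c j ∸ r₁ j)
        big′ = +-cancelˡ-≤ (t * P ^ E) _ _ (begin
          t * P ^ E + P ^ E                          ≡⟨ +-comm (t * P ^ E) _ ⟩
          suc t * P ^ E                              ≤⟨ big ⟩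
          total c                                    ≡⟨ total-split c r₁ r₁≤c ⟩
          total r₁ + total (λ j → c j ∸ r₁ j)        ≡⟨ cong (_+ total (λ j → c j ∸ r₁ j)) total-r₁ ⟩
          t * P ^ E + total (λ j → c j ∸ r₁ j)       ∎)
          where open ≤-Reasoning
    ... | r₂ , r₂≤c-r₁ , r₂-outside , total-r₂ = (λ j → r₁ j + r₂ j) , r≤c , r-outside , total-r
      where
        r≤c : ∀ j → r₁ j + r₂ j ≤ c j
        r≤c j = subst (r₁ j + r₂ j ≤_) (m+[n∸m]≡n (r₁≤c j)) (+-monoʳ-≤ (r₁ j) (r₂≤c-r₁ j))
        r-outside : ∀ j → n ≤ j → r₁ j + r₂ j ≡ 0
        r-outside j n≤j = cong₂ _+_ (r₁-outside j n≤j) (r₂-outside j n≤j)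
        total-r : total (λ j → r₁ j + r₂ j) ≡ suc t * P ^ E
        total-r = begin
          total (λ j → r₁ j + r₂ j)                      ≡⟨ sumTo-cong n (λ j _ → *-distribʳ-+ (P ^ e j) (r₁ j) (r₂ j)) ⟩
          sumTo n (λ j → r₁ j * P ^ e j + r₂ j * P ^ e j) ≡⟨ sumTo-+ n _ _ ⟩
          total r₁ + total r₂                            ≡⟨ cong₂ _+_ total-r₁ total-r₂ ⟩
          t * P ^ E + P ^ E                              ≡⟨ +-comm (t * P ^ E) _ ⟩
          suc t * P ^ E                                  ∎
          where open ≡-Reasoning

module Exchange (k f′ : ℕ) where
  open FiniteSums
  open Expansion k
  open Weights
  open Congruence k f′
  open Membership f

  -- Modulo Q, P ^ exponent n j is P ^ j divided by P ^ (n + 1), and exponent n j ≤ f′.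
  exponent : ℕ → ℕ → ℕ
  exponent n j = (j + f′ + n * f′) % f

  exponent≤f′ : ∀ n j → exponent n j ≤ f′
  exponent≤f′ n j = ≤-pred (m%n<n (j + f′ + n * f′) f)

  n+exponent≡f′+j : ∀ n j → (n + exponent n j) % f ≡ (f′ + j) % f
  n+exponent≡f′+j n j = begin
    (n + (j + f′ + n * f′) % f) % f            ≡⟨ %-distribˡ-+ n _ f ⟩
    (n % f + (j + f′ + n * f′) % f % f) % f    ≡⟨ cong (λ z → (n % f + z) % f) (m%n%n≡m%n (j + f′ + n * f′) f) ⟩
    (n % f + (j + f′ + n * f′) % f) % f        ≡⟨ sym (%-distribˡ-+ n (j + f′ + n * f′) f) ⟩
    (n + (j + f′ + n * f′)) % f                ≡⟨ cong (_% f) (regroup n j f′) ⟩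
    (f′ + j + n * f) % f                       ≡⟨ [m+kn]%n≡m%n (f′ + j) n f ⟩
    (f′ + j) % f                               ∎
    where open ≡-Reasoning
          regroup : ∀ n j f′ → n + (j + f′ + n * f′) ≡ f′ + j + n * suc f′
          regroup = solve-∀

  module _ (n : ℕ) where
    open Subsums k n (exponent n)

    P^n*total≈P^f′*fromDigits : ∀ c → P ^ n * total c ≈ P ^ f′ * fromDigits n c
    P^n*total≈P^f′*fromDigits c = subst₂ _≈_ (sumTo-*ˡ n (P ^ n) _) rhs (≈-sumTo n term)
      where
        swap : ∀ a c b → a * (c * b) ≡ c * (a * b)
        swap = solve-∀
        term : ∀ j → j < n → P ^ n * (c j * P ^ exponent n j) ≈ P ^ f′ * (c j * P ^ j)
        term j _ = subst₂ _≈_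
          (sym (trans (swap (P ^ n) (c j) _) (cong (c j *_) (sym (^-distribˡ-+-* P n (exponent n j))))))
          (sym (trans (swap (P ^ f′) (c j) _) (cong (c j *_) (sym (^-distribˡ-+-* P f′ j)))))
          (≈-*ˡ (c j) (P^-≈ (n + exponent n j) (f′ + j) (n+exponent≡f′+j n j)))
        rhs : sumTo n (λ j → P ^ f′ * (c j * P ^ j)) ≡ P ^ f′ * fromDigits n c
        rhs = trans (sumTo-*ˡ n (P ^ f′) _) (cong (P ^ f′ *_) (sym (fromDigits-sumTo n c)))

    module _ (x₁ : ℕ) (top : ∀ j → n < j → digit P x₁ j ≡ 0) (Q∣x₁ : Q ∣ x₁) where

      private
        c = digit P x₁

      total+top≈0 : total c + c n * P ^ f′ ≈ 0
      total+top≈0 = ≈-cancel-P^ n (≈-trans expand (subst (P ^ f′ * x₁ ≈_) zeros (≈-*ˡ (P ^ f′) (∣⇒≈0 Q∣x₁))))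
        where
          zeros : P ^ f′ * 0 ≡ P ^ n * 0
          zeros = trans (*-zeroʳ (P ^ f′)) (sym (*-zeroʳ (P ^ n)))
          swap : ∀ a x b → a * (x * b) ≡ b * (x * a)
          swap = solve-∀
          expand : P ^ n * (total c + c n * P ^ f′) ≈ P ^ f′ * x₁
          expand = subst₂ _≈_ (sym (*-distribˡ-+ (P ^ n) (total c) _))
                     (trans (sym (*-distribˡ-+ (P ^ f′) (fromDigits n c) _)) (cong (P ^ f′ *_) (sym (split-at-top x₁ n top))))
                     (≈-+ (P^n*total≈P^f′*fromDigits c) (≈-reflexive (swap (P ^ n) (c n) (P ^ f′))))

      -- total c + c n * P ^ f′ is a multiple of Q, positive, and below Q unless total c ≥ P ^ f′.
      P^f′≤total : 0 < x₁ → 2 + c n ≤ P → P ^ f′ ≤ total c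
      P^f′≤total x₁>0 2+cn≤P with P ^ f′ ≤? total c
      ... | yes big  = big
      ... | no small = ⊥-elim (<-irrefl (sym x₁≡0) x₁>0)
        where
          s = total c + c n * P ^ f′
          s<Q : s < Q
          s<Q = m+n≤o⇒m≤o∸n (suc s) (begin
            suc s + 1                              ≤⟨ +-monoˡ-≤ 1 (+-monoˡ-≤ (c n * P ^ f′) (≰⇒> small)) ⟩
            P ^ f′ + c n * P ^ f′ + 1              ≤⟨ +-monoʳ-≤ (P ^ f′ + c n * P ^ f′) (m^n>0 P f′) ⟩
            P ^ f′ + c n * P ^ f′ + P ^ f′         ≡⟨ regroup (c n) (P ^ f′) ⟩
            (2 + c n) * P ^ f′                     ≤⟨ *-monoˡ-≤ (P ^ f′) 2+cn≤P ⟩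
            P * P ^ f′                             ∎)
            where open ≤-Reasoning
                  regroup : ∀ x p → p + x * p + p ≡ (2 + x) * p
                  regroup = solve-∀
          s≡0 : s ≡ 0
          s≡0 = ∣∧<⇒≡0 (≈0⇒∣ total+top≈0) s<Q
          positive-factor : ∀ a b → a * P ^ b ≡ 0 → a ≡ 0
          positive-factor a b ab≡0 = m*n≡0⇒m≡0 a (P ^ b) ⦃ >-nonZero (m^n>0 P b) ⦄ ab≡0
          x₁≡0 : x₁ ≡ 0
          x₁≡0 = begin
            x₁                               ≡⟨ split-at-top x₁ n top ⟩
            fromDigits n c + c n * P ^ n     ≡⟨ cong₂ _+_ (fromDigits-zeros n c low≡0) (cong (_* P ^ n) top≡0) ⟩
            0                                ∎
            where open ≡-Reasoning
                  low≡0 : ∀ j → j < n → c j ≡ 0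
                  low≡0 j j<n = positive-factor (c j) (exponent n j) (sumTo≡0⇒ n _ (m+n≡0⇒m≡0 (total c) s≡0) j j<n)
                  top≡0 : c n ≡ 0
                  top≡0 = positive-factor (c n) f′ (m+n≡0⇒n≡0 (total c) s≡0)

      subdigits≈P^n : 0 < x₁ → 2 + c n ≤ P →
        Σ (ℕ → ℕ) λ r → (∀ j → r j ≤ c j) × (∀ j → n ≤ j → r j ≡ 0) × (fromDigits n r ≈ P ^ n) × (0 < fromDigits n r)
      subdigits≈P^n x₁>0 2+cn≤P with subsum-P^ f′ c (λ j _ f′<e → ⊥-elim (<⇒≱ f′<e (exponent≤f′ n j))) (P^f′≤total x₁>0 2+cn≤P)
      ... | r , r≤c , r-outside , total-r = r , r≤c , r-outside , R≈P^n , R>0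
        where
          R = fromDigits n r
          R≈P^n : R ≈ P ^ n
          R≈P^n = ≈-sym (≈-cancel-P^ f′ (subst (_≈ P ^ f′ * R) (trans (cong (P ^ n *_) total-r) (*-comm (P ^ n) (P ^ f′)))
                                                        (P^n*total≈P^f′*fromDigits r)))
          R>0 : 0 < R
          R>0 with R ≟ 0
          ... | no  R≢0 = n≢0⇒n>0 R≢0
          ... | yes R≡0 = ⊥-elim (<-irrefl (sym (trans (sym total-r) total≡0)) (m^n>0 P f′))
            where total≡0 = sumTo-zeros n _ (λ j j<n → cong (_* P ^ exponent n j) (fromDigits≡0⇒ n r R≡0 j j<n))

  -- Moving the digits a of x to z and the digits b of z to x.
  module Transfer (L x z : ℕ) (a b : ℕ → ℕ) (x<P^L : x < P ^ L) (z<P^L : z < P ^ L) (noCarry : NoCarry₂ x z)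
                  (a≤x : ∀ j → a j ≤ digit P x j) (b≤z : ∀ j → b j ≤ digit P z j) where

    private
      dx′ dz′ : ℕ → ℕ
      dx′ j = digit P x j ∸ a j + b j
      dz′ j = digit P z j ∸ b j + a j

      dx′≤ : ∀ j → dx′ j ≤ digit P x j + digit P z j
      dx′≤ j = +-mono-≤ (m∸n≤m (digit P x j) (a j)) (b≤z j)

      dz′≤ : ∀ j → dz′ j ≤ digit P x j + digit P z j
      dz′≤ j = subst (dz′ j ≤_) (+-comm (digit P z j) _) (+-mono-≤ (m∸n≤m (digit P z j) (b j)) (a≤x j))

      vanish : ∀ (c : ℕ → ℕ) → (∀ j → c j ≤ digit P x j + digit P z j) → ∀ j → L ≤ j → c j ≡ 0
      vanish c c≤ j L≤j = n≤0⇒n≡0 (subst (c j ≤_) (cong₂ _+_ (digit-≥ L x x<P^L j L≤j) (digit-≥ L z z<P^L j L≤j)) (c≤ j))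

      A B : ℕ
      A = fromDigits L a
      B = fromDigits L b

    x′ z′ : ℕ
    x′ = fromDigits L dx′
    z′ = fromDigits L dz′

    digit-x′ : ∀ j → digit P x′ j ≡ dx′ j
    digit-x′ = digit-fromDigits′ L dx′ (λ j → ≤-<-trans (dx′≤ j) (noCarry j)) (vanish dx′ dx′≤)

    digit-z′ : ∀ j → digit P z′ j ≡ dz′ j
    digit-z′ = digit-fromDigits′ L dz′ (λ j → ≤-<-trans (dz′≤ j) (noCarry j)) (vanish dz′ dz′≤)

    digit-x′+z′ : ∀ j → digit P x′ j + digit P z′ j ≡ digit P x j + digit P z j
    digit-x′+z′ j = begin
      digit P x′ j + digit P z′ j                        ≡⟨ cong₂ _+_ (digit-x′ j) (digit-z′ j) ⟩
      (digit P x j ∸ a j + b j) + (digit P z j ∸ b j + a j) ≡⟨ regroup (digit P x j ∸ a j) (b j) (digit P z j ∸ b j) (a j) ⟩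
      (digit P x j ∸ a j + a j) + (digit P z j ∸ b j + b j) ≡⟨ cong₂ _+_ (m∸n+n≡m (a≤x j)) (m∸n+n≡m (b≤z j)) ⟩
      digit P x j + digit P z j                          ∎
      where open ≡-Reasoning
            regroup : ∀ u b v a → (u + b) + (v + a) ≡ (u + a) + (v + b)
            regroup = solve-∀

    private
      moved : ∀ (c d : ℕ → ℕ) (w : ℕ) → w < P ^ L → (∀ j → c j ≤ digit P w j) →
              fromDigits L (λ j → digit P w j ∸ c j + d j) + fromDigits L c ≡ w + fromDigits L d
      moved c d w w<P^L c≤w = begin
        fromDigits L (λ j → digit P w j ∸ c j + d j) + fromDigits L c   ≡⟨ sym (fromDigits-+ L _ c) ⟩
        fromDigits L (λ j → digit P w j ∸ c j + d j + c j)              ≡⟨ fromDigits-cong L (λ j _ → regroup j) ⟩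
        fromDigits L (λ j → digit P w j + d j)                          ≡⟨ fromDigits-+ L (digit P w) d ⟩
        fromDigits L (digit P w) + fromDigits L d                       ≡⟨ cong (_+ fromDigits L d) (fromDigits-digit L w w<P^L) ⟩
        w + fromDigits L d                                              ∎
        where open ≡-Reasoning
              regroup : ∀ j → digit P w j ∸ c j + d j + c j ≡ digit P w j + d j
              regroup j = trans (+-assoc (digit P w j ∸ c j) _ _)
                                (trans (cong (digit P w j ∸ c j +_) (+-comm (d j) (c j)))
                                       (trans (sym (+-assoc (digit P w j ∸ c j) _ _)) (cong (_+ d j) (m∸n+n≡m (c≤w j)))))

    x′+A≡x+B : x′ + A ≡ x + B
    x′+A≡x+B = moved a b x x<P^L a≤x

    z′+B≡z+A : z′ + B ≡ z + A
    z′+B≡z+A = moved b a z z<P^L b≤z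

    B≤x′ : B ≤ x′
    B≤x′ = fromDigits-mono L (λ j _ → m≤n+m (b j) _)

    A≤z′ : A ≤ z′
    A≤z′ = fromDigits-mono L (λ j _ → m≤n+m (a j) _)

    x′+z′≡x+z : x′ + z′ ≡ x + z
    x′+z′≡x+z = +-cancelʳ-≡ (A + B) _ _ (begin
      x′ + z′ + (A + B)   ≡⟨ regroup x′ z′ A B ⟩
      (x′ + A) + (z′ + B) ≡⟨ cong₂ _+_ x′+A≡x+B z′+B≡z+A ⟩
      (x + B) + (z + A)   ≡⟨ regroup′ x z A B ⟩
      x + z + (A + B)     ∎)
      where open ≡-Reasoning
            regroup : ∀ x z a b → x + z + (a + b) ≡ (x + a) + (z + b)
            regroup = solve-∀
            regroup′ : ∀ x z a b → (x + b) + (z + a) ≡ x + z + (a + b)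
            regroup′ = solve-∀

  private
    exchange-sums : ∀ {a b c d u v} → a + b ≡ c + d → u + d ≡ v + b → a + u ≡ c + v
    exchange-sums {a} {b} {c} {d} {u} {v} a+b≡c+d u+d≡v+b = +-cancelʳ-≡ (b + d) _ _ (begin
      a + u + (b + d)   ≡⟨ regroup a u b d ⟩
      (a + b) + (u + d) ≡⟨ cong₂ _+_ a+b≡c+d u+d≡v+b ⟩
      (c + d) + (v + b) ≡⟨ regroup′ c v b d ⟩
      c + v + (b + d)   ∎)
      where open ≡-Reasoning
            regroup : ∀ a u b d → a + u + (b + d) ≡ (a + b) + (u + d)
            regroup = solve-∀
            regroup′ : ∀ c v b d → (c + d) + (v + b) ≡ c + v + (b + d)
            regroup′ = solve-∀

  InW-replace : ∀ {d N x₁ y₁ y} {rest : Vec ℕ (suc d)} (i : Fin (suc d)) → InW P f (suc (suc d)) N (x₁ ∷ rest) →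
                (∀ j → digit P y₁ j + digit P y j ≡ digit P x₁ j + digit P (lookup rest i) j) →
                y₁ + y ≡ x₁ + lookup rest i → 0 < y₁ → y₁ ≈ x₁ → 0 < y → y ≈ lookup rest i →
                InW P f (suc (suc d)) N (y₁ ∷ rest [ i ]≔ y)
  InW-replace {x₁ = x₁} {y₁} {y} {rest} i w@((refl , noCarry) , cond) digits sums y₁>0 y₁≈x₁ y>0 y≈xᵢ =
    (sum , noCarry′) , cond′
    where
      sum : y₁ + vsum (rest [ i ]≔ y) ≡ x₁ + vsum rest
      sum = exchange-sums {y₁} {y} {x₁} {lookup rest i} {vsum (rest [ i ]≔ y)} {vsum rest} sums (vsum-update rest i y)
      noCarry′ : ∀ j → digit P y₁ j + digitSum (rest [ i ]≔ y) j < P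
      noCarry′ j = subst (_< P) (sym same) (noCarry j)
        where same : digit P y₁ j + digitSum (rest [ i ]≔ y) j ≡ digit P x₁ j + digitSum rest j
              same = exchange-sums {digit P y₁ j} {digit P y j} {digit P x₁ j} {digit P (lookup rest i) j}
                                   {digitSum (rest [ i ]≔ y) j} {digitSum rest j} (digits j) (vsum-map-update (λ x → digit P x j) rest i y)
      cond′ : (j : Fin _) → suc (toℕ j) < _ → (0 < lookup (y₁ ∷ rest [ i ]≔ y) j) × qEven P f (lookup (y₁ ∷ rest [ i ]≔ y) j)
      cond′ fzero    _ = y₁>0 , ∣-resp-≈ (≈-sym y₁≈x₁) (proj₂ (InW-head w (s≤s z≤n)))
      cond′ (fsuc j) 2+j<d with j Fin.≟ i
      ... | yes refl = subst (λ z → (0 < z) × qEven P f z) (sym (lookup∘update j rest y))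
                             (y>0 , ∣-resp-≈ (≈-sym y≈xᵢ) (proj₂ (cond (fsuc j) 2+j<d)))
      ... | no  j≢i  = subst (λ z → (0 < z) × qEven P f z) (sym (lookup∘update′ j≢i rest y)) (cond (fsuc j) 2+j<d)

  -- Trade a unit P ^ n of the i-th remaining coordinate for digits r of X₁ worth R ≡ P ^ n (mod Q):
  -- every coordinate stays q-even, X₁ grows by P ^ n - R, and the weight drops.
  swap-unit : ∀ {d N n x₁} {rest : Vec ℕ (suc d)} → InW P f (suc (suc d)) N (x₁ ∷ rest) →
              (i : Fin (suc d)) → 0 < digit P (lookup rest i) n →
              (r : ℕ → ℕ) → (∀ j → r j ≤ digit P x₁ j) → (∀ j → n ≤ j → r j ≡ 0) →
              fromDigits n r ≈ P ^ n → 0 < fromDigits n r →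
              Σ (Vec ℕ (suc (suc d))) λ Y → InW P f (suc (suc d)) N Y × x₁ < first Y × wt Y < wt (x₁ ∷ rest)
  swap-unit {d} {N} {n} {x₁} {rest} w i unit r r≤x₁ r-outside R≈P^n R>0 =
    (x₁ + Δ) ∷ rest [ i ]≔ z′ , wY , m<m+n x₁ Δ>0 , wt-move-to-head x₁ Δ rest i z′ z′+Δ≡xᵢ Δ>0
    where
      xᵢ = lookup rest i
      R = fromDigits n r
      R<P^n : R < P ^ n
      R<P^n = fromDigits-< n r (λ j _ → ≤-<-trans (r≤x₁ j) (digit<P x₁ j))
      Δ = P ^ n ∸ R
      Δ>0 : 0 < Δ
      Δ>0 = m<n⇒0<n∸m R<P^n
      L = suc (N + n)
      <P^L : ∀ {y} → y ≤ N → y < P ^ L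
      <P^L {y} y≤N = <P^ y (≤-trans y≤N (m≤n⇒m≤1+n (m≤m+n N n)))
      noCarry : NoCarry₂ x₁ xᵢ
      noCarry j = ≤-<-trans (+-monoʳ-≤ (digit P x₁ j) (lookup-map≤vsum (λ y → digit P y j) rest i))
                            (subst (_< P) (digit-noCarrySum {X = x₁ ∷ rest} (proj₁ w) j) (digit<P N j))
      open Transfer L x₁ xᵢ r (δ n) (<P^L (InW-head≤ w))
                    (<P^L (≤-trans (lookup≤vsum rest i) (≤-trans (m≤n+m _ x₁) (≤-reflexive (proj₁ (proj₁ w))))))
                    noCarry r≤x₁ (δ-≤ n (digit P xᵢ) unit)
      A≡R : fromDigits L r ≡ R
      A≡R = fromDigits-extend n L r (m≤n⇒m≤1+n (m≤n+m n N)) (λ j n≤j _ → r-outside j n≤j)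
      B≡P^n : fromDigits L (δ n) ≡ P ^ n
      B≡P^n = fromDigits-δ L n (s≤s (m≤n+m n N))
      x′+R≡x₁+P^n : x′ + R ≡ x₁ + P ^ n
      x′+R≡x₁+P^n = subst₂ (λ u v → x′ + u ≡ x₁ + v) A≡R B≡P^n x′+A≡x+B
      z′+P^n≡xᵢ+R : z′ + P ^ n ≡ xᵢ + R
      z′+P^n≡xᵢ+R = subst₂ (λ u v → z′ + v ≡ xᵢ + u) A≡R B≡P^n z′+B≡z+A
      x′≡x₁+Δ : x′ ≡ x₁ + Δ
      x′≡x₁+Δ = +-cancelʳ-≡ R _ _ (trans x′+R≡x₁+P^n (sym (trans (+-assoc x₁ Δ R) (cong (x₁ +_) (m∸n+n≡m (<⇒≤ R<P^n))))))
      z′+Δ≡xᵢ : z′ + Δ ≡ xᵢ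
      z′+Δ≡xᵢ = +-cancelʳ-≡ R _ _ (trans (trans (+-assoc z′ Δ R) (cong (z′ +_) (m∸n+n≡m (<⇒≤ R<P^n)))) z′+P^n≡xᵢ+R)
      wY : InW P f (suc (suc d)) N ((x₁ + Δ) ∷ rest [ i ]≔ z′)
      wY = subst (λ y₁ → InW P f _ N (y₁ ∷ rest [ i ]≔ z′)) x′≡x₁+Δ
             (InW-replace i w digit-x′+z′ x′+z′≡x+z
                (<-≤-trans (m^n>0 P n) (subst (_≤ x′) B≡P^n B≤x′)) (≈-cancelˡ-+ x′+R≡x₁+P^n R≈P^n)
                (<-≤-trans R>0 (subst (_≤ z′) A≡R A≤z′))        (≈-cancelˡ-+ z′+P^n≡xᵢ+R (≈-sym R≈P^n)))

  exchange : ∀ {d N n x₁} {rest : Vec ℕ (suc d)} → InW P f (suc (suc d)) N (x₁ ∷ rest) →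
             (∀ j → n < j → digit P N j ≡ 0) → digit P x₁ n < digit P N n →
             Σ (Vec ℕ (suc (suc d))) λ Y → InW P f (suc (suc d)) N Y × x₁ < first Y × wt Y < wt (x₁ ∷ rest)
  exchange {N = N} {n} {x₁} {rest} w top x₁ₙ<Nₙ =
    let r , r≤x₁ , r-outside , R≈P^n , R>0 =
          subdigits≈P^n n x₁ (digit-head-above {xs = rest} (proj₁ w) top) (proj₂ (InW-head w (s≤s z≤n)))
                        (proj₁ (InW-head w (s≤s z≤n))) (<-≤-trans (s≤s x₁ₙ<Nₙ) (digit<P N n))
        i , unit = digit-held-elsewhere {n = n} {xs = rest} (proj₁ w) x₁ₙ<Nₙ
    in swap-unit w i unit r r≤x₁ r-outside R≈P^n R>0

module Consequences (k f′ : ℕ) where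
  open Expansion k
  open Weights
  open Congruence k f′
  open Exchange k f′
  open Membership f

  Good : ∀ d → ℕ → Vec ℕ d → Set
  Good d N X = Modest P f d N X ⊎ Optimal P f d N X

  Good⇒InW : ∀ {d N} {X : Vec ℕ d} → Good d N X → InW P f d N X
  Good⇒InW (inj₁ modest)  = proj₁ modest
  Good⇒InW (inj₂ optimal) = proj₁ optimal

  improvable⇒¬Good : ∀ {d N} {X : Vec ℕ (suc d)} →
                     (Σ (Vec ℕ (suc d)) λ Y → InW P f (suc d) N Y × first X < first Y × wt Y < wt X) → ¬ Good (suc d) N X
  improvable⇒¬Good {X = _ ∷ _} (_ ∷ _ , wY , head< , _) (inj₁ (_ , maximal)) = maximal _ wY (here head<)
  improvable⇒¬Good             (Y     , wY , _     , lighter) (inj₂ (_ , minimal)) = <⇒≱ lighter (minimal Y wY)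

  head-carries-top : ∀ {d N n x₁} {rest : Vec ℕ d} → Good (suc d) N (x₁ ∷ rest) →
                     (∀ j → n < j → digit P N j ≡ 0) → digit P x₁ n ≡ digit P N n
  head-carries-top {zero} {n = n} {rest = []} good top = cong (λ z → digit P z n) (InW-single (Good⇒InW good))
  head-carries-top {suc d} {N} {n} {x₁} {rest} good top with <-cmp (digit P x₁ n) (digit P N n)
  ... | tri≈ _ eq _ = eq
  ... | tri> _ _ gt = ⊥-elim (<⇒≱ gt (digit-head≤ {xs = rest} (proj₁ (Good⇒InW good)) n))
  ... | tri< lt _ _ = ⊥-elim (improvable⇒¬Good (exchange (Good⇒InW good) top lt) good)

  top-bounds : ∀ {M x n} → digit P M n ≢ 0 → (∀ j → n < j → digit P M j ≡ 0) → (∀ j → n < j → digit P x j ≡ 0) →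
               digit P x n ≡ digit P M n → (digit P M n * P ^ n ≤ x) × (M < 2 * x)
  top-bounds {M} {x} {n} Mₙ≢0 topM topx xₙ≡Mₙ = lower , M<2x
    where
      a = digit P M n
      lower : a * P ^ n ≤ x
      lower = subst (λ z → z * P ^ n ≤ x) xₙ≡Mₙ (top*P^n≤ x n topx)
      M<2x : M < 2 * x
      M<2x = <-≤-trans (<[1+top]*P^n M n topM) (begin
        suc a * P ^ n     ≤⟨ *-monoˡ-≤ (P ^ n) (+-monoˡ-≤ a (n≢0⇒n>0 Mₙ≢0)) ⟩
        (a + a) * P ^ n   ≡⟨ cong (λ z → (a + z) * P ^ n) (sym (+-identityʳ a)) ⟩
        2 * a * P ^ n     ≡⟨ *-assoc 2 a (P ^ n) ⟩
        2 * (a * P ^ n)   ≤⟨ *-monoʳ-≤ 2 lower ⟩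
        2 * x             ∎)
        where open ≤-Reasoning

  light-∷ : ∀ {d M n y₁} {Z : Vec ℕ d} → InW P f (suc d) M (y₁ ∷ Z) →
            digit P M n ≢ 0 → (∀ j → n < j → digit P M j ≡ 0) → digit P y₁ n ≡ digit P M n →
            (0 < M ∸ y₁ → wt Z < 2 * (M ∸ y₁)) → wt (y₁ ∷ Z) < 2 * M
  light-∷ {M = M} {y₁ = y₁} {Z} w Mₙ≢0 top carries tail =
    subst (λ z → wt (y₁ ∷ Z) < 2 * z) y₁+sum≡M
      (wt-∷-< y₁ Z rest<y₁ (λ pos → subst (λ z → wt Z < 2 * z) (sym sum≡) (tail (subst (0 <_) sum≡ pos))))
    where
      sum≡ : vsum Z ≡ M ∸ y₁
      sum≡ = proj₁ (proj₁ (InW-tail w))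
      y₁+sum≡M : y₁ + vsum Z ≡ M
      y₁+sum≡M = trans (cong (y₁ +_) sum≡) (m+[n∸m]≡n (InW-head≤ w))
      rest<y₁ : vsum Z < y₁
      rest<y₁ = +-cancelˡ-< y₁ _ _ (subst₂ _<_ (sym y₁+sum≡M) (cong (y₁ +_) (+-identityʳ y₁))
                  (proj₂ (top-bounds Mₙ≢0 top (digit-head-above {xs = Z} (proj₁ w) top) carries)))

  modest-tail : ∀ {d N x₁} {rest : Vec ℕ d} → Modest P f (suc d) N (x₁ ∷ rest) → Modest P f d (N ∸ x₁) rest
  modest-tail {x₁ = x₁} (w , maximal) = InW-tail w , λ Z wZ rest<Z →
    maximal (x₁ ∷ Z) (InW-∷ wZ (InW-noCarry₂ w) (InW-head w) (m+[n∸m]≡n (InW-head≤ w))) (there rest<Z)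

  modest-light : ∀ d N (X : Vec ℕ d) → Modest P f d N X → 0 < N → wt X < 2 * N
  modest-light zero    N []         (((refl , _) , _) , _) ()
  modest-light (suc d) N (x₁ ∷ rest) modest N>0 with topDigit N N>0
  ... | n , Nₙ≢0 , top =
    light-∷ (proj₁ modest) Nₙ≢0 top (head-carries-top (inj₁ modest) top)
            (modest-light d (N ∸ x₁) rest (modest-tail modest))

  improve-head : ∀ {d M n} (Y : Vec ℕ (suc (suc d))) → InW P f _ M Y → (∀ j → n < j → digit P M j ≡ 0) →
                 Acc _<_ (M ∸ first Y) →
                 Σ (Vec ℕ (suc (suc d))) λ Y′ → InW P f _ M Y′ × digit P (first Y′) n ≡ digit P M n
  improve-head {M = M} {n} (y₁ ∷ ys) w top (acc smaller) with <-cmp (digit P y₁ n) (digit P M n)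
  ... | tri≈ _ eq _ = y₁ ∷ ys , w , eq
  ... | tri> _ _ gt = ⊥-elim (<⇒≱ gt (digit-head≤ {xs = ys} (proj₁ w) n))
  ... | tri< lt _ _ = continue (exchange w top lt)
    where
      -- A helper instead of `with`: abstracting over the witness built by `exchange` is prohibitively slow.
      continue : (Σ (Vec ℕ _) λ Y′ → InW P f _ M Y′ × y₁ < first Y′ × wt Y′ < wt (y₁ ∷ ys)) →
                 Σ (Vec ℕ _) λ Y′ → InW P f _ M Y′ × digit P (first Y′) n ≡ digit P M n
      continue (Y′@(_ ∷ _) , w′ , y₁<y₁′ , _) = improve-head Y′ w′ top (smaller (∸-monoʳ-< y₁<y₁′ (InW-head≤ w′)))

  head-carrier : ∀ {d M n} (Y : Vec ℕ (suc d)) → InW P f (suc d) M Y → (∀ j → n < j → digit P M j ≡ 0) →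
                 Σ (Vec ℕ (suc d)) λ Y′ → InW P f (suc d) M Y′ × digit P (first Y′) n ≡ digit P M n
  head-carrier {zero} {n = n} (y ∷ []) w top = y ∷ [] , w , cong (λ z → digit P z n) (InW-single w)
  head-carrier {suc d}        Y        w top = improve-head Y w top (<-wellFounded _)

  light-element : ∀ {d M} (Y : Vec ℕ d) → InW P f d M Y →
                  Σ (Vec ℕ d) λ Y′ → InW P f d M Y′ × (0 < M → wt Y′ < 2 * M)
  light-element {M = zero}  Y  w = Y , w , λ ()
  light-element {zero} {suc M} [] ((() , _) , _)
  light-element {suc d} {M@(suc _)} Y w with topDigit M z<s
  ... | n , Mₙ≢0 , top with head-carrier Y w top
  ...   | y₁ ∷ Z , w′ , carries with light-element Z (InW-tail w′)
  ...     | Z′ , wZ′ , tail = y₁ ∷ Z′ , w″ , λ _ → light-∷ w″ Mₙ≢0 top carries tail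
    where w″ = InW-∷ wZ′ (InW-noCarry₂ w′) (InW-head w′) (m+[n∸m]≡n (InW-head≤ w′))

  good-light : ∀ {d N} {X : Vec ℕ d} → Good d N X → 0 < N → wt X < 2 * N
  good-light {X = X} (inj₁ modest)            = modest-light _ _ X modest
  good-light {X = X} (inj₂ (w , minimal)) N>0 with light-element X w
  ... | Y , wY , light = ≤-<-trans (minimal Y wY) (light N>0)

  absorb : ∀ {d N x₁ y₁} {rest ys : Vec ℕ (suc d)} → InW P f (suc (suc d)) N (x₁ ∷ rest) →
           InW P f (suc (suc d)) (N ∸ x₁) (y₁ ∷ ys) → InW P f (suc (suc d)) N ((x₁ + y₁) ∷ ys)
  absorb {d} {N} {x₁} {y₁} {rest} {ys} wx wy = InW-∷ (InW-tail wy) noCarry head sum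
    where
      M = N ∸ x₁
      y₁+M∸y₁≡M : y₁ + (M ∸ y₁) ≡ M
      y₁+M∸y₁≡M = m+[n∸m]≡n (InW-head≤ wy)
      digitsM : ∀ j → digit P M j ≡ digit P y₁ j + digit P (M ∸ y₁) j
      digitsM j = trans (cong (λ z → digit P z j) (sym y₁+M∸y₁≡M)) (digit-+ y₁ (M ∸ y₁) (InW-noCarry₂ wy) j)
      x₁y₁ : NoCarry₂ x₁ y₁
      x₁y₁ j = ≤-<-trans (+-monoʳ-≤ (digit P x₁ j) (subst (digit P y₁ j ≤_) (sym (digitsM j)) (m≤m+n _ _)))
                         (InW-noCarry₂ wx j)
      noCarry : NoCarry₂ (x₁ + y₁) (M ∸ y₁)
      noCarry j = subst (_< P) (sym (begin
        digit P (x₁ + y₁) j + digit P (M ∸ y₁) j               ≡⟨ cong (_+ digit P (M ∸ y₁) j) (digit-+ x₁ y₁ x₁y₁ j) ⟩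
        digit P x₁ j + digit P y₁ j + digit P (M ∸ y₁) j       ≡⟨ +-assoc (digit P x₁ j) _ _ ⟩
        digit P x₁ j + (digit P y₁ j + digit P (M ∸ y₁) j)     ≡⟨ cong (digit P x₁ j +_) (sym (digitsM j)) ⟩
        digit P x₁ j + digit P M j                             ∎)) (InW-noCarry₂ wx j)
        where open ≡-Reasoning
      head : 1 ≤ suc d → (0 < x₁ + y₁) × qEven P f (x₁ + y₁)
      head _ = <-≤-trans (proj₁ (InW-head wx (s≤s z≤n))) (m≤m+n x₁ y₁) ,
               ∣m∣n⇒∣m+n (proj₂ (InW-head wx (s≤s z≤n))) (proj₂ (InW-head wy (s≤s z≤n)))
      sum : x₁ + y₁ + (M ∸ y₁) ≡ N
      sum = trans (+-assoc x₁ y₁ _) (trans (cong (x₁ +_) y₁+M∸y₁≡M) (m+[n∸m]≡n (InW-head≤ wx)))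

  -- Adding the first coordinate of an element of W(N - X₁) to X₁ would beat X.
  remainder-W-empty : ∀ {d N x₁} {rest : Vec ℕ (suc d)} → Good (suc (suc d)) N (x₁ ∷ rest) →
                      ¬ (Σ (Vec ℕ (suc (suc d))) λ Y → InW P f (suc (suc d)) (N ∸ x₁) Y)
  remainder-W-empty {x₁ = x₁} (inj₁ (wx , maximal)) (y₁ ∷ ys , wy) =
    maximal ((x₁ + y₁) ∷ ys) (absorb wx wy) (here (m<m+n x₁ (proj₁ (InW-head wy (s≤s z≤n)))))
  remainder-W-empty {N = N} {x₁} {rest} (inj₂ (wx , minimal)) (Y@(y₁ ∷ _) , wy) with light-element Y wy
  ... | z₁ ∷ zs , wz , light = <⇒≱ lighter (minimal ((x₁ + z₁) ∷ zs) (absorb wx wz))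
    where
      M = N ∸ x₁
      M>0 : 0 < M
      M>0 = <-≤-trans (proj₁ (InW-head wy (s≤s z≤n))) (InW-head≤ wy)
      sum≡M : vsum rest ≡ M
      sum≡M = proj₁ (proj₁ (InW-tail wx))
      lighter : wt ((x₁ + z₁) ∷ zs) < wt (x₁ ∷ rest)
      lighter = begin-strict
        wt ((x₁ + z₁) ∷ zs)          ≡⟨ wt-+-head x₁ z₁ zs ⟩
        x₁ + wt (z₁ ∷ zs)            <⟨ +-monoʳ-< x₁ (light M>0) ⟩
        x₁ + 2 * M                   ≡⟨ cong (λ z → x₁ + (M + z)) (+-identityʳ M) ⟩
        x₁ + (M + M)                 ≤⟨ +-monoʳ-≤ x₁ (+-monoʳ-≤ M (subst (_≤ wt rest) sum≡M (vsum≤wt rest))) ⟩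
        x₁ + (M + wt rest)           ≡⟨ cong (λ z → x₁ + (z + wt rest)) (sym sum≡M) ⟩
        x₁ + (vsum rest + wt rest)   ≡⟨ sym (wt-∷ x₁ rest) ⟩
        wt (x₁ ∷ rest)               ∎
        where open ≤-Reasoning

module ClassSums (k f′ : ℕ) where
  open FiniteSums
  open Expansion k
  open Congruence k f′
  open Membership f

  -- Junk value 0 past the end of the vector.
  entry : ∀ {m} → Vec ℕ m → ℕ → ℕ
  entry []       _       = 0
  entry (x ∷ xs) zero    = x
  entry (x ∷ xs) (suc i) = entry xs i

  entry-mono : ∀ {m} (u v : Vec ℕ m) → (∀ i → lookup u i ≤ lookup v i) → ∀ i → entry u i ≤ entry v i
  entry-mono []       []       u≤v i       = z≤n
  entry-mono (x ∷ u) (y ∷ v) u≤v zero    = u≤v fzero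
  entry-mono (x ∷ u) (y ∷ v) u≤v (suc i) = entry-mono u v (u≤v ∘ fsuc) i

  entry-tabulate : ∀ {m} (g : ℕ → ℕ) i → i < m → entry (tabulate {n = m} (g ∘ toℕ)) i ≡ g i
  entry-tabulate {suc m} g zero    _         = refl
  entry-tabulate {suc m} g (suc i) (s≤s i<m) = entry-tabulate (g ∘ suc) i i<m

  entry-vadd : ∀ {m} (u v : Vec ℕ m) i → entry (vadd u v) i ≡ entry u i + entry v i
  entry-vadd []      []      i       = refl
  entry-vadd (x ∷ u) (y ∷ v) zero    = refl
  entry-vadd (x ∷ u) (y ∷ v) (suc i) = entry-vadd u v i

  classSum : (ℕ → ℕ) → ℕ → ℕ → ℕ
  classSum c i K = sumTo K (λ t → c (i + t * f))

  entry-Γ : ∀ n i → i < f → entry (Γ P f n) i ≡ classSum (digit P n) i (suc n)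
  entry-Γ n i i<f = trans (entry-tabulate (λ i → digitSumFrom P n i f (suc n)) i i<f) (digitSumFrom≡ (suc n))
    where digitSumFrom≡ : ∀ K → digitSumFrom P n i f K ≡ classSum (digit P n) i K
          digitSumFrom≡ zero    = refl
          digitSumFrom≡ (suc K) = trans (+-comm (digit P n (i + K * f)) _) (cong (_+ digit P n (i + K * f)) (digitSumFrom≡ K))

  classSum-+ : ∀ a b i K → classSum (λ j → a j + b j) i K ≡ classSum a i K + classSum b i K
  classSum-+ a b i K = sumTo-+ K _ _

  private
    i+t*f-injective : ∀ {i i′ t t′} → i < f → i′ < f → i′ + t′ * f ≡ i + t * f → i′ ≡ i × t′ ≡ t
    i+t*f-injective {i} {i′} {t} {t′} i<f i′<f eq = i′≡i , *-cancelʳ-≡ t′ t f (+-cancelˡ-≡ i _ _ (trans (cong (_+ t′ * f) (sym i′≡i)) eq))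
      where i′≡i : i′ ≡ i
            i′≡i = begin
              i′                ≡⟨ sym (m<n⇒m%n≡m i′<f) ⟩
              i′ % f            ≡⟨ sym ([m+kn]%n≡m%n i′ t′ f) ⟩
              (i′ + t′ * f) % f ≡⟨ cong (_% f) eq ⟩
              (i + t * f) % f   ≡⟨ [m+kn]%n≡m%n i t f ⟩
              i % f             ≡⟨ m<n⇒m%n≡m i<f ⟩
              i                 ∎
              where open ≡-Reasoning

  classSum-δ : ∀ i t i′ K → i < f → i′ < f → t < K → classSum (δ (i + t * f)) i′ K ≡ δ i i′
  classSum-δ i t i′ K i<f i′<f t<K with i′ ≟ i
  ... | yes refl = trans (sumTo-cong K (λ t′ _ → trans (δ-+ i (t * f) (t′ * f)) (trans (δ-*f t t′) (sym (*-identityʳ _)))))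
                         (trans (sumTo-δ K t (λ _ → 1) t<K) (sym (δ-refl i)))
    where δ-*f : ∀ t t′ → δ (t * f) (t′ * f) ≡ δ t t′
          δ-*f t t′ with t′ ≟ t
          ... | yes refl = trans (δ-refl (t * f)) (sym (δ-refl t))
          ... | no  t′≢t = trans (δ-≢ _ _ (λ eq → t′≢t (*-cancelʳ-≡ t′ t f eq))) (sym (δ-≢ t t′ t′≢t))
  ... | no i′≢i = trans (sumTo-zeros K _ (λ t′ _ → δ-≢ (i + t * f) (i′ + t′ * f) (λ eq → i′≢i (proj₁ (i+t*f-injective {t = t} {t′} i<f i′<f eq))))) (sym (δ-≢ i i′ i′≢i))

  sumTo-by-classes : ∀ K g → sumTo (K * f) g ≡ sumTo f (λ i → sumTo K (λ t → g (i + t * f)))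
  sumTo-by-classes zero    g = sym (sumTo-zeros f _ (λ _ _ → refl))
  sumTo-by-classes (suc K) g = begin
    sumTo (f + K * f) g                                                    ≡⟨ cong (λ z → sumTo z g) (+-comm f (K * f)) ⟩
    sumTo (K * f + f) g                                                    ≡⟨ sumTo-split (K * f) f g ⟩
    sumTo (K * f) g + sumTo f (λ i → g (K * f + i))                        ≡⟨ cong₂ _+_ (sumTo-by-classes K g) (sumTo-cong f (λ i _ → cong g (+-comm (K * f) i))) ⟩
    sumTo f (λ i → sumTo K (λ t → g (i + t * f))) + sumTo f (λ i → g (i + K * f)) ≡⟨ sym (sumTo-+ f _ _) ⟩
    sumTo f (λ i → sumTo (suc K) (λ t → g (i + t * f)))                    ∎
    where open ≡-Reasoning

  -- Since P ^ f ≡ 1 (mod Q), a number is congruent to Σ_{i < f} (class sum i) P ^ i.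
  fromDigits≈classSums : ∀ L K c → (∀ j → L ≤ j → c j ≡ 0) → L ≤ K →
                         fromDigits L c ≈ sumTo f (λ i → classSum c i K * P ^ i)
  fromDigits≈classSums L K c c-outside L≤K =
    subst₂ _≈_ (sym by-classes) (sumTo-cong f (λ i _ → sumTo-*ʳ K (P ^ i) (λ t → c (i + t * f))))
      (≈-sumTo f (λ i _ → ≈-sumTo K (λ t _ → ≈-*ˡ (c (i + t * f)) (P^[m+t*f]≈P^m i t))))
    where
      by-classes : fromDigits L c ≡ sumTo f (λ i → sumTo K (λ t → c (i + t * f) * P ^ (i + t * f)))
      by-classes = trans (fromDigits-sumTo L c)
        (trans (sym (sumTo-extend L (K * f) _ (≤-trans L≤K (m≤m*n K f)) (λ j L≤j _ → cong (_* P ^ j) (c-outside j L≤j))))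
               (sumTo-by-classes K _))

  classSums≡0⇒ : ∀ L K c → L ≤ K → (∀ i → i < f → classSum c i K ≡ 0) → fromDigits L c ≡ 0
  classSums≡0⇒ L K c L≤K zeros =
    fromDigits-zeros L c (λ j j<L → sumTo≡0⇒ (K * f) c all≡0 j (<-≤-trans j<L (≤-trans L≤K (m≤m*n K f))))
    where all≡0 : sumTo (K * f) c ≡ 0
          all≡0 = trans (sumTo-by-classes K c) (sumTo-zeros f _ zeros)

  split-digits : ∀ T c (u : ℕ → ℕ) K → sumTo f u ≡ T → (∀ i → i < f → u i ≤ classSum c i K) →
                 Σ (ℕ → ℕ) λ a → (∀ j → a j ≤ c j) × (∀ i → i < f → classSum a i K ≡ u i)
  split-digits zero c u K Σu≡0 u≤ =
    (λ _ → 0) , (λ _ → z≤n) , λ i i<f → trans (sumTo-zeros K _ (λ _ _ → refl)) (sym (n≤0⇒n≡0 (subst (u i ≤_) Σu≡0 (≤-sumTo f u i i<f))))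
  split-digits (suc T) c u K Σu≡1+T u≤ with sumTo>0⇒ f u (subst (0 <_) (sym Σu≡1+T) z<s)
  ... | i , i<f , uᵢ>0 with sumTo>0⇒ K (λ t → c (i + t * f)) (<-≤-trans uᵢ>0 (u≤ i i<f))
  ...   | t , t<K , cⱼ>0 = a , a≤c , classSum-a
    where
      j = i + t * f
      c′ = λ j′ → c j′ ∸ δ j j′
      u′ = λ i′ → u i′ ∸ δ i i′
      δ≤c : ∀ j′ → δ j j′ ≤ c j′
      δ≤c = δ-≤ j c cⱼ>0
      δ≤u : ∀ i′ → δ i i′ ≤ u i′
      δ≤u = δ-≤ i u uᵢ>0
      Σu′≡T : sumTo f u′ ≡ T
      Σu′≡T = +-cancelʳ-≡ 1 _ _ (begin
        sumTo f u′ + 1                     ≡⟨ cong (sumTo f u′ +_) (sym (trans (sumTo-cong f (λ i′ _ → sym (*-identityʳ (δ i i′)))) (sumTo-δ f i (λ _ → 1) i<f))) ⟩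
        sumTo f u′ + sumTo f (δ i)         ≡⟨ sym (sumTo-+ f u′ (δ i)) ⟩
        sumTo f (λ i′ → u′ i′ + δ i i′)    ≡⟨ sumTo-cong f (λ i′ _ → m∸n+n≡m (δ≤u i′)) ⟩
        sumTo f u                          ≡⟨ Σu≡1+T ⟩
        suc T                              ≡⟨ +-comm 1 T ⟩
        T + 1                              ∎)
        where open ≡-Reasoning
      classSum-c : ∀ i′ → i′ < f → classSum c i′ K ≡ classSum c′ i′ K + δ i i′
      classSum-c i′ i′<f = trans (sumTo-cong K (λ t′ _ → sym (m∸n+n≡m (δ≤c (i′ + t′ * f)))))
                                 (trans (classSum-+ c′ (δ j) i′ K) (cong (classSum c′ i′ K +_) (classSum-δ i t i′ K i<f i′<f t<K)))
      u′≤ : ∀ i′ → i′ < f → u′ i′ ≤ classSum c′ i′ K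
      u′≤ i′ i′<f = +-cancelʳ-≤ (δ i i′) _ _ (subst₂ _≤_ (sym (m∸n+n≡m (δ≤u i′))) (classSum-c i′ i′<f) (u≤ i′ i′<f))
      rec = split-digits T c′ u′ K Σu′≡T u′≤
      a = λ j′ → proj₁ rec j′ + δ j j′
      a≤c : ∀ j′ → a j′ ≤ c j′
      a≤c j′ = subst (a j′ ≤_) (m∸n+n≡m (δ≤c j′)) (+-monoˡ-≤ (δ j j′) (proj₁ (proj₂ rec) j′))
      classSum-a : ∀ i′ → i′ < f → classSum a i′ K ≡ u i′
      classSum-a i′ i′<f = trans (classSum-+ (proj₁ rec) (δ j) i′ K)
        (trans (cong₂ _+_ (proj₂ (proj₂ rec) i′ i′<f) (classSum-δ i t i′ K i<f i′<f t<K)) (m∸n+n≡m (δ≤u i′)))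

  𝔍-piece : ∀ a L K → (∀ j → L ≤ j → a j ≡ 0) → L ≤ K → (v : Vec ℕ f) → InJ P f v →
            (∀ i → i < f → classSum a i K ≡ entry v i) → (0 < fromDigits L a) × qEven P f (fromDigits L a)
  𝔍-piece a L K a-outside L≤K v (n , n>0 , Q∣n , Γn≡v) classSums = positive , ∣-resp-≈ n≈A Q∣n
    where
      n-outside : ∀ j → n ≤ j → digit P n j ≡ 0
      n-outside = digit-≥ n n (n<P^n n)
      classSums-n : ∀ i → i < f → classSum (digit P n) i (suc n) ≡ entry v i
      classSums-n i i<f = trans (sym (entry-Γ n i i<f)) (cong (λ z → entry z i) Γn≡v)
      n≈A : n ≈ fromDigits L a
      n≈A = ≈-trans (subst (_≈ sumTo f (λ i → classSum (digit P n) i (suc n) * P ^ i)) (fromDigits-digit n n (n<P^n n))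
                           (fromDigits≈classSums n (suc n) (digit P n) n-outside (n≤1+n n)))
                    (≈-sym (subst (fromDigits L a ≈_) (sumTo-cong f (λ i i<f → cong (_* P ^ i) (trans (classSums i i<f) (sym (classSums-n i i<f)))))
                                  (fromDigits≈classSums L K a a-outside L≤K)))
      positive : 0 < fromDigits L a
      positive with fromDigits L a ≟ 0
      ... | no  A≢0 = n≢0⇒n>0 A≢0
      ... | yes A≡0 = ⊥-elim (<-irrefl (sym n≡0) n>0)
        where
          a≡0 : ∀ j → a j ≡ 0
          a≡0 j with j <? L
          ... | yes j<L = fromDigits≡0⇒ L a A≡0 j j<L
          ... | no  j≮L = a-outside j (≮⇒≥ j≮L)
          n≡0 : n ≡ 0
          n≡0 = trans (sym (fromDigits-digit n n (n<P^n n))) (classSums≡0⇒ n (suc n) (digit P n) (n≤1+n n)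
                  (λ i i<f → trans (classSums-n i i<f) (trans (sym (classSums i i<f)) (sumTo-zeros K _ (λ t _ → a≡0 _)))))

  -- Peel off one element of 𝔍 at a time; the leftover digits form the last coordinate.
  realise : ∀ m (vs : Vec (Vec ℕ f) m) c L K → (∀ j → c j < P) → (∀ j → L ≤ j → c j ≡ 0) → L ≤ K →
            (∀ i → i < f → entry (vecSum vs) i ≤ classSum c i K) → ((t : Fin m) → InJ P f (lookup vs t)) →
            Σ (Vec ℕ (suc m)) λ Y → InW P f (suc m) (fromDigits L c) Y
  realise zero [] c L K c<P c-outside L≤K _ _ =
    fromDigits L c ∷ [] , ((+-identityʳ _ , λ j → subst (_< P) (sym (+-identityʳ _)) (digit<P _ j)) , λ { fzero (s≤s ()) })
  realise (suc m) (v ∷ vs) c L K c<P c-outside L≤K dominated 𝔍s = fromDigits L a ∷ proj₁ rec , wY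
    where
      dominated-v : ∀ i → i < f → entry v i + entry (vecSum vs) i ≤ classSum c i K
      dominated-v i i<f = subst (_≤ classSum c i K) (entry-vadd v (vecSum vs) i) (dominated i i<f)
      split = split-digits (sumTo f (entry v)) c (entry v) K refl (λ i i<f → ≤-trans (m≤m+n _ _) (dominated-v i i<f))
      a = proj₁ split
      a≤c : ∀ j → a j ≤ c j
      a≤c = proj₁ (proj₂ split)
      c′ = λ j → c j ∸ a j
      a-outside : ∀ j → L ≤ j → a j ≡ 0
      a-outside j L≤j = n≤0⇒n≡0 (subst (a j ≤_) (c-outside j L≤j) (a≤c j))
      classSum-c : ∀ i → classSum c i K ≡ classSum a i K + classSum c′ i K
      classSum-c i = trans (sumTo-cong K (λ t _ → sym (m+[n∸m]≡n (a≤c (i + t * f))))) (classSum-+ a c′ i K)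
      dominated′ : ∀ i → i < f → entry (vecSum vs) i ≤ classSum c′ i K
      dominated′ i i<f = +-cancelˡ-≤ (entry v i) _ _
        (subst (_ ≤_) (trans (classSum-c i) (cong (_+ classSum c′ i K) (proj₂ (proj₂ split) i i<f))) (dominated-v i i<f))
      rec = realise m vs c′ L K (λ j → ≤-<-trans (m∸n≤m (c j) (a j)) (c<P j))
                    (λ j L≤j → trans (cong (_∸ a j) (c-outside j L≤j)) (0∸n≡0 (a j))) L≤K dominated′ (𝔍s ∘ fsuc)
      wY : InW P f (suc (suc m)) (fromDigits L c) (fromDigits L a ∷ proj₁ rec)
      wY = InW-∷ (proj₂ rec) (fromDigits-split-noCarry L c a c<P c-outside a≤c)
                 (λ _ → 𝔍-piece a L K a-outside L≤K v (𝔍s fzero) (proj₂ (proj₂ split)))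
                 (fromDigits-split L c a c<P c-outside a≤c)

  I⇒W-nonempty : ∀ d M → InI P f (suc d) (Γ P f M) → Σ (Vec ℕ (suc d)) λ Y → InW P f (suc d) M Y
  I⇒W-nonempty d M (_ , vs , 𝔍s , dominated , _) =
    subst (λ z → Σ (Vec ℕ (suc d)) λ Y → InW P f (suc d) z Y) (fromDigits-digit M M (n<P^n M))
      (realise d vs (digit P M) M (suc M) (digit<P M) (digit-≥ M M (n<P^n M)) (n≤1+n M) dominated′ 𝔍s)
    where
      dominated′ : ∀ i → i < f → entry (vecSum vs) i ≤ classSum (digit P M) i (suc M)
      dominated′ i i<f = subst (entry (vecSum vs) i ≤_) (entry-Γ M i i<f) (entry-mono (vecSum vs) (Γ P f M) dominated i)

open Expansion using (digit-head-above)
open Weights using (vsum≤wt)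
open Consequences using (Good; Good⇒InW; head-carries-top; top-bounds; good-light; remainder-W-empty)
open ClassSums using (I⇒W-nonempty)

proposition3p14 : (p f d N : ℕ) → Prime p → 1 ≤ f → 1 ≤ d → 1 ≤ N →
    (n : ℕ) → digit p N n ≢ 0 → ((j : ℕ) → n < j → digit p N j ≡ 0) →
    (X : Vec ℕ d) → (Modest p f d N X ⊎ Optimal p f d N X) →
    ((digit p N n * p ^ n ≤ first X) × (N < 2 * first X)) ×
    ((N ≤ wt X) × (wt X < 2 * N)) ×
    (2 ≤ d → ¬ (Σ (Vec ℕ d) λ Y → InW p f d (N ∸ first X) Y) × ¬ InI p f d (Γ p f (N ∸ first X)))
proposition3p14 zero          _ _ _ p-prime = ⊥-elim (¬prime[0] p-prime)
proposition3p14 (suc zero)    _ _ _ p-prime = ⊥-elim (¬prime[1] p-prime)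
proposition3p14 (suc (suc k)) (suc f′) (suc d) N _ _ _ N>0 n Nₙ≢0 top (x₁ ∷ rest) good =
  top-bounds k f′ Nₙ≢0 top (digit-head-above k {xs = rest} (proj₁ w) top) (head-carries-top k f′ good top) ,
  (subst (_≤ wt (x₁ ∷ rest)) (proj₁ (proj₁ w)) (vsum≤wt (x₁ ∷ rest)) , good-light k f′ good N>0) ,
  remainder-empty d rest good
  where
    w : InW (2 + k) (suc f′) (suc d) N (x₁ ∷ rest)
    w = Good⇒InW k f′ good
    remainder-empty : ∀ d (rest : Vec ℕ d) → Good k f′ (suc d) N (x₁ ∷ rest) → 2 ≤ suc d →
                      ¬ (Σ (Vec ℕ (suc d)) λ Y → InW (2 + k) (suc f′) (suc d) (N ∸ x₁) Y) ×
                      ¬ InI (2 + k) (suc f′) (suc d) (Γ (2 + k) (suc f′) (N ∸ x₁))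
    remainder-empty (suc d) rest good (s≤s (s≤s z≤n)) =
      remainder-W-empty k f′ good , λ inI → remainder-W-empty k f′ good (I⇒W-nonempty k f′ (suc d) (N ∸ x₁) inI)
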